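{- Let $M=p_1^{n_1}\cdots p_K^{n_K}$ with distinct primes and $n_\nu\in\mathbb{N}$, and let $A\oplus B=\mathbb{Z}_M$. Every fiber $Z$ splits with parity either $(A,B)$ or $(B,A)$. In particular, if $Z$ is a fiber in the $p_i$ direction, then for any $a\in\Sigma_A(Z)$ and $b\in\Sigma_B(Z)$ we have $\Sigma_A(Z)\subset\Pi(a,p_i^{n_i-1})$ and $\Sigma_B(Z)\subset\Pi(b,p_i^{n_i-1})$.
   Context: $A\oplus B=\mathbb{Z}_M$ means every element of $\mathbb{Z}_M$ is uniquely $a+b$ with $a\in A,b\in B$. For $x\in\mathbb{Z}_M$, $\Pi(x,p_i^{\alpha})=\{x'\in\mathbb{Z}_M:p_i^\alpha\mid x-x'\}$. $F_i=\{0,M/p_i,\dots,(p_i-1)M/p_i\}$; a fiber in the $p_i$ direction is a set $x*F_i=\{x+f:f\in F_i\}$; a fiber is a fiber in some direction $p_i$. For $Z\subset\mathbb{Z}_M$, $\Sigma_A(Z)=\{a\in A:a+b\in Z\text{ for some }b\in B\}$, $\Sigma_B(Z)=\{b\in B:a+b\in Z\text{ for some }a\in A\}$. A fiber $Z$ in the $p_i$ direction splits with parity $(A,B)$ if $p_i^{n_i}\mid a-a'$ for all $a,a'\in\Sigma_A(Z)$ and $p_i^{n_i-1}\,\|\,b-b'$ ($p_i^{n_i-1}$ divides, $p_i^{n_i}$ does not) for all distinct $b,b'\in\Sigma_B(Z)$; parity $(B,A)$ is the same with $A,B$ swapped. -}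

module Defs where

open import Data.Nat using (ℕ; zero; suc; _+_; _*_; _∸_; _^_; _<_; _≤_; ∣_-_∣)
open import Data.Nat.Divisibility using (_∣_)
open import Data.Fin using (Fin; zero; suc)
open import Data.Product using (_×_; Σ; ∃; ∃-syntax)
open import Data.Sum using (_⊎_)
open import Relation.Binary.PropositionalEquality using (_≡_; _≢_)
open import Relation.Nullary using (¬_)

prodFin : (K : ℕ) → (Fin K → ℕ) → ℕ
prodFin zero    f = 1
prodFin (suc K) f = f zero * prodFin K (λ i → f (suc i))

infix 4 _∣-_
_∣-_ : ℕ → ℕ → ℕ → Set
(d ∣- x) y = d ∣ ∣ x - y ∣

-- subsets of ℤ_M, represented as predicates on ℕ (elements are the residues 0 … M-1)
Subset : Set₁
Subset = ℕ → Set

Tiling : ℕ → Subset → Subset → Set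
Tiling M A B =
    (∀ a → A a → a < M)
  × (∀ b → B b → b < M)
  × (∀ x → x < M → ∃[ a ] ∃[ b ] (A a × B b × (M ∣- (a + b)) x))
  × (∀ a b a' b' → A a → B b → A a' → B b' →
       (M ∣- (a + b)) (a' + b') → a ≡ a' × b ≡ b')

-- membership (mod M) in the fiber x * F_i = {x + k·(M/p) : 0 ≤ k < p},
-- where s = M/p is the step.
InFiber : (M s p x : ℕ) → ℕ → Set
InFiber M s p x y = ∃[ k ] (k < p × (M ∣- y) (x + k * s))

ΣA : Subset → Subset → Subset → Subset
ΣA A B Z a = A a × ∃[ b ] (B b × Z (a + b))

ΣB : Subset → Subset → Subset → Subset
ΣB A B Z b = B b × ∃[ a ] (A a × Z (a + b))

-- a fiber in the p direction (p^n ∥ M) splits with parity (A,B)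
SplitsWithParity : (p n : ℕ) → (SA SB : Subset) → Set
SplitsWithParity p n SA SB =
    (∀ a a' → SA a → SA a' → (p ^ n ∣- a) a')
  × (∀ b b' → SB b → SB b' → b ≢ b' →
       (p ^ (n ∸ 1) ∣- b) b' × ¬ ((p ^ n ∣- b) b'))

{-# OPTIONS --safe #-}
-- The tiling says 𝟏A ⋆ 𝟏B = 𝟙 in the group semiring ℕ[ℤ_M]. Frobenius, F^q ≡ F(X^q) (mod q),
-- and a mass count show that dilating A by any r prime to M still tiles with B (Tijdeman).
-- Hence Sands' theorem: if a − a′ and b′ − b have the same divisors in M, some such r maps one
-- to the other, so r a + b ≡ r a′ + b′ and the uniqueness of tilings by rA ⊕ B gives a = a′, b = b′.
-- Two tiles a + b and a′ + b′ on a fiber in the p direction (p^n ∥ M) differ by a multiple of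
-- M/p, so a − a′ ≡ b′ − b modulo every divisor of M/p; if p^n divided neither a − a′ nor b − b′,
-- these differences would have the same divisors in M. So any two tiles of the fiber agree
-- modulo p^n in their A-part or in their B-part, which forces one of the parts to be constant
-- modulo p^n along the fiber; the other part is then constant modulo p^(n−1) and injective
-- modulo p^n, because the p points of the fiber are distinct modulo p^n.

module Submission where

open import Defs
open import Data.Nat using (ℕ; _+_; _*_; _∸_; _^_; _<_; _≤_)
open import Data.Nat.Primality using (Prime)
open import Data.Fin using (Fin)
open import Data.Product using (_×_)
open import Data.Sum using (_⊎_)
open import Relation.Binary.PropositionalEquality using (_≡_)
open import Function.Definitions using (Injective)

open import Data.Nat
open import Data.Nat.Properties
open import Data.Nat.Divisibility
open import Data.Nat.DivMod
open import Data.Nat.GCD using (gcd; gcd[m,n]∣m; gcd[m,n]∣n; gcd-greatest; gcd[m,n]≢0; module Bézout)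
open import Data.Nat.Coprimality using (Coprime; coprime-Bézout; coprime-divisor)
open import Data.Nat.Primality
open import Data.Nat.Primality.Factorisation using (factorise; factorisationHasAllPrimeFactors; PrimeFactorisation)
open import Data.Nat.Combinatorics using (_C_; nCn≡1; nCk≡n!/k![n-k]!; k![n∸k]!∣n!)
open import Data.Nat.ListAction using (product)
open import Data.Nat.ListAction.Properties using (∈⇒∣product)
open import Data.Nat.Tactic.RingSolver using (solve; solve-∀)
open import Data.Fin using (zero; suc; toℕ)
import Data.Fin.Properties as Finₚ
open import Data.List using (List; []; _∷_; map; replicate; _++_; filter)
open import Data.List.Properties using (map-id; map-cong; map-∘; map-++; map-replicate)
open import Data.List.Membership.Propositional using (_∈_)
open import Data.List.Membership.Propositional.Properties using (∈-filter⁺; ∈-filter⁻)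
open import Data.List.Relation.Unary.All as All using (All; lookup)
open import Data.List.Relation.Unary.All.Properties using (filter⁺)
open import Data.List.Relation.Unary.Any using (here; there)
open import Data.Product using (∃; ∃₂; ∃-syntax; _,_; proj₁; proj₂)
open import Data.Sum using (inj₁; inj₂; [_,_]′)
open import Data.Empty using (⊥; ⊥-elim)
open import Function using (_∘_; id)
open import Level using (0ℓ)
open import Relation.Binary.Bundles using (Setoid)
open import Relation.Binary.PropositionalEquality
open import Relation.Nullary using (¬_; Dec; yes; no; map′; ¬?)
open import Relation.Nullary.Decidable using (decidable-stable)
open import Algebra.Bundles using (Semiring)
open import Algebra.Properties.CommutativeSemigroup *-commutativeSemigroup using (x∙yz≈y∙xz)
open import Algebra.Properties.Semiring.Sum +-*-semiring
  using (sum-syntax; ∑-comm; ∑-distrib-+; *-distribˡ-sum; sum-cong-≗)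
import Algebra.Properties.Semiring.Binomial as Binomial


-- Congruences

infix 4 _≡_[mod_]
_≡_[mod_] : ℕ → ℕ → ℕ → Set
x ≡ y [mod m ] = ∃₂ λ k l → x + k * m ≡ y + l * m

module _ {m : ℕ} where
  open ≡-Reasoning

  ≡mod-refl : ∀ {x} → x ≡ x [mod m ]
  ≡mod-refl = 0 , 0 , refl

  ≡mod-reflexive : ∀ {x y} → x ≡ y → x ≡ y [mod m ]
  ≡mod-reflexive refl = ≡mod-refl

  ≡mod-sym : ∀ {x y} → x ≡ y [mod m ] → y ≡ x [mod m ]
  ≡mod-sym (k , l , e) = l , k , sym e

  ≡mod-trans : ∀ {x y z} → x ≡ y [mod m ] → y ≡ z [mod m ] → x ≡ z [mod m ]
  ≡mod-trans {x} {y} {z} (k , l , e) (k′ , l′ , e′) = k + k′ , l + l′ , (begin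
    x + (k + k′) * m     ≡⟨ solve (x ∷ k ∷ k′ ∷ m ∷ []) ⟩
    (x + k * m) + k′ * m ≡⟨ cong (_+ k′ * m) e ⟩
    (y + l * m) + k′ * m ≡⟨ solve (y ∷ l ∷ k′ ∷ m ∷ []) ⟩
    (y + k′ * m) + l * m ≡⟨ cong (_+ l * m) e′ ⟩
    (z + l′ * m) + l * m ≡⟨ solve (z ∷ l ∷ l′ ∷ m ∷ []) ⟩
    z + (l + l′) * m     ∎)

  ≡mod-+ : ∀ {x y u v} → x ≡ y [mod m ] → u ≡ v [mod m ] → x + u ≡ y + v [mod m ]
  ≡mod-+ {x} {y} {u} {v} (k , l , e) (k′ , l′ , e′) = k + k′ , l + l′ , (begin
    x + u + (k + k′) * m         ≡⟨ solve (x ∷ u ∷ k ∷ k′ ∷ m ∷ []) ⟩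
    (x + k * m) + (u + k′ * m)   ≡⟨ cong₂ _+_ e e′ ⟩
    (y + l * m) + (v + l′ * m)   ≡⟨ solve (y ∷ v ∷ l ∷ l′ ∷ m ∷ []) ⟩
    y + v + (l + l′) * m         ∎)

  ≡mod-*ˡ : ∀ c {x y} → x ≡ y [mod m ] → c * x ≡ c * y [mod m ]
  ≡mod-*ˡ c {x} {y} (k , l , e) = c * k , c * l , (begin
    c * x + c * k * m ≡⟨ solve (c ∷ x ∷ k ∷ m ∷ []) ⟩
    c * (x + k * m)   ≡⟨ cong (c *_) e ⟩
    c * (y + l * m)   ≡⟨ solve (c ∷ y ∷ l ∷ m ∷ []) ⟩
    c * y + c * l * m ∎)

  ≡mod-*ʳ : ∀ c {x y} → x ≡ y [mod m ] → x * c ≡ y * c [mod m ]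
  ≡mod-*ʳ c {x} {y} eq = subst₂ _≡_[mod m ] (*-comm c x) (*-comm c y) (≡mod-*ˡ c eq)

  ≡mod-+-cancelʳ : ∀ c {x y} → x + c ≡ y + c [mod m ] → x ≡ y [mod m ]
  ≡mod-+-cancelʳ c {x} {y} (k , l , e) = k , l , +-cancelʳ-≡ c _ _ (begin
    x + k * m + c ≡⟨ solve (x ∷ k ∷ m ∷ c ∷ []) ⟩
    x + c + k * m ≡⟨ e ⟩
    y + c + l * m ≡⟨ solve (y ∷ c ∷ l ∷ m ∷ []) ⟩
    y + l * m + c ∎)

  ≡mod-+-cancelˡ : ∀ c {x y} → c + x ≡ c + y [mod m ] → x ≡ y [mod m ]
  ≡mod-+-cancelˡ c {x} {y} eq = ≡mod-+-cancelʳ c (subst₂ _≡_[mod m ] (+-comm c x) (+-comm c y) eq)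

  [k*m+x]≡x : ∀ k x → k * m + x ≡ x [mod m ]
  [k*m+x]≡x k x = 0 , k , trans (+-identityʳ _) (+-comm (k * m) x)

  ∣⇒≡0 : ∀ {x} → m ∣ x → x ≡ 0 [mod m ]
  ∣⇒≡0 {x} (divides q refl) = subst (_≡ 0 [mod m ]) (+-identityʳ (q * m)) ([k*m+x]≡x q 0)

  ≡0⇒∣ : ∀ {x} → x ≡ 0 [mod m ] → m ∣ x
  ≡0⇒∣ {x} (k , l , e) = divides (l ∸ k) (begin
    x                 ≡⟨ m+n∸n≡m x (k * m) ⟨
    x + k * m ∸ k * m ≡⟨ cong (_∸ k * m) e ⟩
    l * m ∸ k * m     ≡⟨ *-distribʳ-∸ m l k ⟨
    (l ∸ k) * m       ∎)

  ≡mod-+-∣ : ∀ {x d} → m ∣ d → x + d ≡ x [mod m ]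
  ≡mod-+-∣ {x} {d} m∣d = subst (x + d ≡_[mod m ]) (+-identityʳ x) (≡mod-+ (≡mod-refl {x}) (∣⇒≡0 m∣d))

  ≡mod⇒∣-∣ : ∀ {x y} → x ≡ y [mod m ] → m ∣ ∣ x - y ∣
  ≡mod⇒∣-∣ {x} {y} eq with ≤-total x y
  ... | inj₁ x≤y = subst (m ∣_) (sym (m≤n⇒∣m-n∣≡n∸m x≤y)) (≡0⇒∣ (≡mod-+-cancelˡ x
          (subst₂ _≡_[mod m ] (sym (m+[n∸m]≡n x≤y)) (sym (+-identityʳ x)) (≡mod-sym eq))))
  ... | inj₂ y≤x = subst (m ∣_) (trans (sym (m≤n⇒∣m-n∣≡n∸m y≤x)) (∣-∣-comm y x)) (≡0⇒∣ (≡mod-+-cancelˡ y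
          (subst₂ _≡_[mod m ] (sym (m+[n∸m]≡n y≤x)) (sym (+-identityʳ y)) eq)))

  ∣-∣⇒≡mod : ∀ {x y} → m ∣ ∣ x - y ∣ → x ≡ y [mod m ]
  ∣-∣⇒≡mod {x} {y} m∣ with ≤-total x y
  ... | inj₁ x≤y = ≡mod-sym (subst (_≡ x [mod m ]) (m+[n∸m]≡n x≤y)
          (≡mod-+-∣ (subst (m ∣_) (m≤n⇒∣m-n∣≡n∸m x≤y) m∣)))
  ... | inj₂ y≤x = subst (_≡ y [mod m ]) (m+[n∸m]≡n y≤x)
          (≡mod-+-∣ (subst (m ∣_) (trans (∣-∣-comm x y) (m≤n⇒∣m-n∣≡n∸m y≤x)) m∣))

≡mod-∣ : ∀ {d m x y} → d ∣ m → x ≡ y [mod m ] → x ≡ y [mod d ]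
≡mod-∣ {d} {x = x} {y} (divides q refl) (k , l , e) = k * q , l * q , (begin
  x + k * q * d   ≡⟨ cong (x +_) (*-assoc k q d) ⟩
  x + k * (q * d) ≡⟨ e ⟩
  y + l * (q * d) ≡⟨ cong (y +_) (*-assoc l q d) ⟨
  y + l * q * d   ∎)
  where open ≡-Reasoning

≡mod-scale : ∀ c {m x y} → x ≡ y [mod m ] → c * x ≡ c * y [mod c * m ]
≡mod-scale c {m} {x} {y} (k , l , e) = k , l , (begin
  c * x + k * (c * m) ≡⟨ solve (c ∷ x ∷ k ∷ m ∷ []) ⟩
  c * (x + k * m)     ≡⟨ cong (c *_) e ⟩
  c * (y + l * m)     ≡⟨ solve (c ∷ y ∷ l ∷ m ∷ []) ⟩
  c * y + l * (c * m) ∎)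
  where open ≡-Reasoning

≡mod-setoid : ℕ → Setoid 0ℓ 0ℓ
≡mod-setoid m = record
  { Carrier = ℕ ; _≈_ = _≡_[mod m ]
  ; isEquivalence = record { refl = ≡mod-refl ; sym = ≡mod-sym ; trans = ≡mod-trans } }

module _ (m : ℕ) .{{_ : NonZero m}} where

  %≡mod : ∀ x → x % m ≡ x [mod m ]
  %≡mod x = x / m , 0 , trans (sym (m≡m%n+[m/n]*n x m)) (sym (+-identityʳ x))

  ≡mod⇒%≡% : ∀ {x y} → x ≡ y [mod m ] → x % m ≡ y % m
  ≡mod⇒%≡% {x} {y} (k , l , e) = begin
    x % m           ≡⟨ [m+kn]%n≡m%n x k m ⟨
    (x + k * m) % m ≡⟨ cong (_% m) e ⟩
    (y + l * m) % m ≡⟨ [m+kn]%n≡m%n y l m ⟩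
    y % m           ∎
    where open ≡-Reasoning

  %≡%⇒≡mod : ∀ {x y} → x % m ≡ y % m → x ≡ y [mod m ]
  %≡%⇒≡mod {x} {y} e = ≡mod-trans (≡mod-sym (%≡mod x)) (subst (_≡ y [mod m ]) (sym e) (%≡mod y))

  ≡mod-difference : ∀ x y → ∃ λ c → y + c ≡ x [mod m ]
  ≡mod-difference x y = x + (y * m ∸ y) , subst (_≡ x [mod m ]) y*m+x≡ ([k*m+x]≡x y x)
    where
    open ≡-Reasoning
    y*m+x≡ : y * m + x ≡ y + (x + (y * m ∸ y))
    y*m+x≡ = begin
      y * m + x             ≡⟨ cong (_+ x) (m+[n∸m]≡n (m≤m*n y m)) ⟨
      y + (y * m ∸ y) + x   ≡⟨ +-assoc y _ x ⟩
      y + ((y * m ∸ y) + x) ≡⟨ cong (y +_) (+-comm _ x) ⟩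
      y + (x + (y * m ∸ y)) ∎

_≟_[mod_] : ∀ x y m .{{_ : NonZero m}} → Dec (x ≡ y [mod m ])
x ≟ y [mod m ] = map′ (%≡%⇒≡mod m) (≡mod⇒%≡% m) (x % m ≟ y % m)


-- Finite sums

-- Opaque, so that unification never unfolds a sum into a fold over Fin; the lemmas in this
-- block are its interface.
opaque
  ∑< : ℕ → (ℕ → ℕ) → ℕ
  ∑< n f = ∑[ i < n ] f (toℕ i)

  sum≡∑< : ∀ n f → ∑[ i < n ] f (toℕ i) ≡ ∑< n f
  sum≡∑< n f = refl

  ∑<-suc : ∀ n f → ∑< (suc n) f ≡ f 0 + ∑< n (λ i → f (suc i))
  ∑<-suc n f = refl

  ∑<-sucʳ : ∀ n f → ∑< (suc n) f ≡ ∑< n f + f n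
  ∑<-sucʳ zero    f = +-comm (f 0) 0
  ∑<-sucʳ (suc n) f = trans (cong (f 0 +_) (∑<-sucʳ n (λ i → f (suc i)))) (sym (+-assoc (f 0) _ _))

  ∑<-cong : ∀ n {f g} → (∀ i → i < n → f i ≡ g i) → ∑< n f ≡ ∑< n g
  ∑<-cong n f≗g = sum-cong-≗ (λ i → f≗g (toℕ i) (Finₚ.toℕ<n i))

  ∑<-cong-≗ : ∀ n {f g} → (∀ i → f i ≡ g i) → ∑< n f ≡ ∑< n g
  ∑<-cong-≗ n f≗g = ∑<-cong n (λ i _ → f≗g i)

  ∑<-comm : ∀ m n (f : ℕ → ℕ → ℕ) → ∑< m (λ i → ∑< n (f i)) ≡ ∑< n (λ j → ∑< m (λ i → f i j))
  ∑<-comm m n f = ∑-comm {m} {n} (λ i j → f (toℕ i) (toℕ j))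

  ∑<-distrib-+ : ∀ n f g → ∑< n (λ i → f i + g i) ≡ ∑< n f + ∑< n g
  ∑<-distrib-+ n f g = ∑-distrib-+ {n} (λ i → f (toℕ i)) (λ i → g (toℕ i))

  *-distribˡ-∑< : ∀ n c f → c * ∑< n f ≡ ∑< n (λ i → c * f i)
  *-distribˡ-∑< n c f = *-distribˡ-sum {n} c (λ i → f (toℕ i))

  *-distribʳ-∑< : ∀ n c f → ∑< n f * c ≡ ∑< n (λ i → f i * c)
  *-distribʳ-∑< n c f = trans (*-comm _ c) (trans (*-distribˡ-∑< n c f) (∑<-cong-≗ n (λ i → *-comm c (f i))))

  ∑<-const : ∀ n c → ∑< n (λ _ → c) ≡ n * c
  ∑<-const zero    c = refl
  ∑<-const (suc n) c = cong (c +_) (∑<-const n c)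

  ∑<-zero : ∀ n {f} → (∀ i → i < n → f i ≡ 0) → ∑< n f ≡ 0
  ∑<-zero n f≡0 = trans (∑<-cong n f≡0) (trans (∑<-const n 0) (*-zeroʳ n))

  ∑<-pick : ∀ n {f} c → c < n → (∀ i → i < n → i ≢ c → f i ≡ 0) → ∑< n f ≡ f c
  ∑<-pick (suc n) {f} zero    _       off =
    trans (cong (f 0 +_) (∑<-zero n (λ i i<n → off (suc i) (s≤s i<n) λ ()))) (+-identityʳ (f 0))
  ∑<-pick (suc n) {f} (suc c) (s≤s c<n) off = trans
    (cong (_+ ∑< n (f ∘ suc)) (off 0 z<s λ ()))
    (∑<-pick n c c<n (λ i i<n i≢c → off (suc i) (s≤s i<n) (i≢c ∘ suc-injective)))

  ∑<-cong-≡mod : ∀ n {q f g} → (∀ i → i < n → f i ≡ g i [mod q ]) → ∑< n f ≡ ∑< n g [mod q ]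
  ∑<-cong-≡mod zero    _    = ≡mod-refl
  ∑<-cong-≡mod (suc n) f≡g = ≡mod-+ (f≡g 0 z<s) (∑<-cong-≡mod n (λ i i<n → f≡g (suc i) (s≤s i<n)))

  ≤-∑< : ∀ n f {i} → i < n → f i ≤ ∑< n f
  ≤-∑< (suc n) f {zero}  _         = m≤m+n (f 0) _
  ≤-∑< (suc n) f {suc i} (s≤s i<n) = ≤-trans (≤-∑< n (λ j → f (suc j)) i<n) (m≤n+m _ (f 0))

  ∑<-≤1⇒unique : ∀ n f {i j} → ∑< n f ≤ 1 → i < n → j < n → 1 ≤ f i → 1 ≤ f j → i ≡ j
  ∑<-≤1⇒unique (suc n) f {zero}  {zero}  _ _ _ _ _ = refl
  ∑<-≤1⇒unique (suc n) f {zero}  {suc j} ∑≤1 _ (s≤s j<n) fi fj =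
    ⊥-elim (<⇒≱ (+-mono-≤ fi (≤-trans fj (≤-∑< n (λ k → f (suc k)) j<n))) ∑≤1)
  ∑<-≤1⇒unique (suc n) f {suc i} {zero}  ∑≤1 (s≤s i<n) _ fi fj =
    ⊥-elim (<⇒≱ (+-mono-≤ fj (≤-trans fi (≤-∑< n (λ k → f (suc k)) i<n))) ∑≤1)
  ∑<-≤1⇒unique (suc n) f {suc i} {suc j} ∑≤1 (s≤s i<n) (s≤s j<n) fi fj =
    cong suc (∑<-≤1⇒unique n (λ k → f (suc k)) (≤-trans (m≤n+m _ (f 0)) ∑≤1) i<n j<n fi fj)

  ∑<-≡length⇒all-one : ∀ n f → (∀ i → i < n → 1 ≤ f i) → ∑< n f ≡ n → ∀ i → i < n → f i ≡ 1
  ∑<-≡length⇒all-one n f pos ∑≡n i i<n =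
    ≤-antisym (m∸n≡0⇒m≤n (n≤0⇒n≡0 (≤-trans (≤-∑< n excess i<n) (≤-reflexive excess≡0)))) (pos i i<n)
    where
    excess : ℕ → ℕ
    excess j = f j ∸ 1
    excess≡0 : ∑< n excess ≡ 0
    excess≡0 = +-cancelˡ-≡ n _ 0 (begin
      n + ∑< n excess                   ≡⟨ cong (_+ ∑< n excess) (trans (sym (*-identityʳ n)) (sym (∑<-const n 1))) ⟩
      ∑< n (λ _ → 1) + ∑< n excess      ≡⟨ ∑<-distrib-+ n (λ _ → 1) excess ⟨
      ∑< n (λ j → 1 + excess j)         ≡⟨ ∑<-cong n (λ j j<n → m+[n∸m]≡n (pos j j<n)) ⟩
      ∑< n f                            ≡⟨ trans ∑≡n (sym (+-identityʳ n)) ⟩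
      n + 0                             ∎)
      where open ≡-Reasoning

∑<²-≤1⇒unique : ∀ m n (h : ℕ → ℕ → ℕ) → ∑< m (λ i → ∑< n (h i)) ≤ 1 →
                ∀ {i j i′ j′} → i < m → j < n → i′ < m → j′ < n → 1 ≤ h i j → 1 ≤ h i′ j′ → i ≡ i′ × j ≡ j′
∑<²-≤1⇒unique m n h ∑≤1 {i} {j} {i′} {j′} i<m j<n i′<m j′<n hij hi′j′
  with refl ← ∑<-≤1⇒unique m (λ k → ∑< n (h k)) ∑≤1 i<m i′<m
                (≤-trans hij (≤-∑< n (h i) j<n)) (≤-trans hi′j′ (≤-∑< n (h i′) j′<n))
  = refl , ∑<-≤1⇒unique n (h i) (≤-trans (≤-∑< m (λ k → ∑< n (h k)) i<m) ∑≤1) j<n j′<n hij hi′j′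


-- Primes

prime⇒∤1 : ∀ {p} → Prime p → ¬ p ∣ 1
prime⇒∤1 {suc (suc _)} _ p∣1 with () ← ∣1⇒≡1 p∣1

prime∣^⇒∣ : ∀ {p} → Prime p → ∀ m n → p ∣ m ^ n → p ∣ m
prime∣^⇒∣ pp m zero    p∣1 = ⊥-elim (prime⇒∤1 pp p∣1)
prime∣^⇒∣ pp m (suc n) p∣ with euclidsLemma m (m ^ n) pp p∣
... | inj₁ p∣m   = p∣m
... | inj₂ p∣m^n = prime∣^⇒∣ pp m n p∣m^n

prime∣prime⇒≡ : ∀ {p q} → Prime p → Prime q → p ∣ q → p ≡ q
prime∣prime⇒≡ pp pq p∣q with prime⇒irreducible pq p∣q
... | inj₁ refl = ⊥-elim (prime⇒∤1 pp ∣-refl)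
... | inj₂ p≡q  = p≡q

prime∤⇒coprime : ∀ {p d} → Prime p → ¬ p ∣ d → Coprime d p
prime∤⇒coprime pp p∤d (i∣d , i∣p) with prime⇒irreducible pp i∣p
... | inj₁ i≡1 = i≡1
... | inj₂ refl = ⊥-elim (p∤d i∣d)

prime∣!⇒≤ : ∀ {p} → Prime p → ∀ m → p ∣ m ! → p ≤ m
prime∣!⇒≤ pp zero    p∣1 = ⊥-elim (prime⇒∤1 pp p∣1)
prime∣!⇒≤ pp (suc m) p∣ with euclidsLemma (suc m) (m !) pp p∣
... | inj₁ p∣1+m = ∣⇒≤ p∣1+m
... | inj₂ p∣m!  = m≤n⇒m≤1+n (prime∣!⇒≤ pp m p∣m!)

prime∣C : ∀ {p} → Prime p → ∀ {k} → 0 < k → k < p → p ∣ p C k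
prime∣C {p} pp {k} 0<k k<p = [ id , ⊥-elim ∘ p∤k![p∸k]! ]′ (euclidsLemma (p C k) (k ! * (p ∸ k) !) pp p∣C*k![p∸k]!)
  where
  instance _ = k !* (p ∸ k) !≢0
  n∣n! : ∀ {n} → NonZero n → n ∣ n !
  n∣n! {suc n} _ = m∣m*n (n !)
  p∣C*k![p∸k]! : p ∣ (p C k) * (k ! * (p ∸ k) !)
  p∣C*k![p∸k]! = subst (p ∣_)
    (sym (trans (cong (_* (k ! * (p ∸ k) !)) (nCk≡n!/k![n-k]! (<⇒≤ k<p))) (m/n*n≡m (k![n∸k]!∣n! (<⇒≤ k<p)))))
    (n∣n! (prime⇒nonZero pp))
  p∤k![p∸k]! : ¬ p ∣ k ! * (p ∸ k) !
  p∤k![p∸k]! p∣ with euclidsLemma (k !) ((p ∸ k) !) pp p∣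
  ... | inj₁ p∣k!     = <⇒≱ k<p (prime∣!⇒≤ pp k p∣k!)
  ... | inj₂ p∣[p∸k]! = <⇒≱ (∸-monoʳ-< 0<k (<⇒≤ k<p)) (prime∣!⇒≤ pp (p ∸ k) p∣[p∸k]!)

NoCommonPrimeFactor : ℕ → ℕ → Set
NoCommonPrimeFactor r m = ∀ {q} → Prime q → q ∣ r → ¬ q ∣ m

∣p^[1+j]*m⇒∣p^j*m : ∀ {p} → Prime p → ∀ m j {d} → d ∣ p ^ suc j * m → ¬ p ^ suc j ∣ d → d ∣ p ^ j * m
∣p^[1+j]*m⇒∣p^j*m {p} pp m zero {d} d∣ p∤d = subst (d ∣_) (sym (+-identityʳ m))
  (coprime-divisor (prime∤⇒coprime pp (p∤d ∘ subst (_∣ d) (sym (*-identityʳ p))))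
                   (subst (d ∣_) (cong (_* m) (*-identityʳ p)) d∣))
∣p^[1+j]*m⇒∣p^j*m {p} pp m (suc j) {d} d∣ p^[2+j]∤d with p ∣? d
... | no p∤d = coprime-divisor (prime∤⇒coprime pp p∤d) (subst (d ∣_) (*-assoc p (p ^ suc j) m) d∣)
... | yes (divides d′ refl) = subst₂ _∣_ (*-comm p d′) (sym (*-assoc p (p ^ j) m)) (*-monoʳ-∣ p d′∣p^j*m)
  where
  instance _ = prime⇒nonZero pp
  d′∣p^j*m : d′ ∣ p ^ j * m
  d′∣p^j*m = ∣p^[1+j]*m⇒∣p^j*m pp m j
    (*-cancelˡ-∣ p (subst₂ _∣_ (*-comm d′ p) (*-assoc p (p ^ suc j) m) d∣))
    (λ p^[1+j]∣d′ → p^[2+j]∤d (subst (p ^ suc (suc j) ∣_) (*-comm p d′) (*-monoʳ-∣ p p^[1+j]∣d′)))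

*-cancelʳ-≡mod-p^[1+j] : ∀ {p} → Prime p → ∀ {m} j → ¬ p ∣ m → ∀ {k k′} → k < p → k′ < p →
                         k * (p ^ j * m) ≡ k′ * (p ^ j * m) [mod p ^ suc j ] → k ≡ k′
*-cancelʳ-≡mod-p^[1+j] {p} pp {m} j p∤m {k} {k′} k<p k′<p eq = ∣m-n∣≡0⇒m≡n (<-∣⇒≡0 ∣k-k′∣<p p∣∣k-k′∣)
  where
  instance _ = prime⇒nonZero pp
  instance _ = m^n≢0 p j
  p^j*p∣p^j*[∣k-k′∣*m] : p ^ j * p ∣ p ^ j * (∣ k - k′ ∣ * m)
  p^j*p∣p^j*[∣k-k′∣*m] = subst₂ _∣_ (*-comm p (p ^ j)) (x∙yz≈y∙xz ∣ k - k′ ∣ (p ^ j) m)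
    (subst (p ^ suc j ∣_) (sym (*-distribʳ-∣-∣ (p ^ j * m) k k′)) (≡mod⇒∣-∣ eq))
  p∣∣k-k′∣ : p ∣ ∣ k - k′ ∣
  p∣∣k-k′∣ with euclidsLemma ∣ k - k′ ∣ m pp (*-cancelˡ-∣ (p ^ j) p^j*p∣p^j*[∣k-k′∣*m])
  ... | inj₁ p∣ = p∣
  ... | inj₂ p∣m = ⊥-elim (p∤m p∣m)
  ∣k-k′∣<p : ∣ k - k′ ∣ < p
  ∣k-k′∣<p = ≤-<-trans (∣m-n∣≤m⊔n k k′) (⊔-lub k<p k′<p)
  <-∣⇒≡0 : ∀ {n} → n < p → p ∣ n → n ≡ 0
  <-∣⇒≡0 {zero}  _   _   = refl
  <-∣⇒≡0 {suc n} n<p p∣n = ⊥-elim (<⇒≱ n<p (∣⇒≤ p∣n))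


-- The group semiring ℕ[ℤ_M]

-- A function ℤ_M → ℕ is represented by any map ℕ → ℕ with the right values on [0, M), hence _≈_.
-- δ u is the point mass at the class of u, and _⋆_ is convolution.
module GroupSemiring (M : ℕ) .{{_ : NonZero M}} where
  open ≡-Reasoning

  Fn : Set
  Fn = ℕ → ℕ

  infix 4 _≈_
  _≈_ : Fn → Fn → Set
  f ≈ g = ∀ x → x < M → f x ≡ g x

  opaque
    δ : ℕ → Fn
    δ u x with u ≟ x [mod M ]
    ... | yes _ = 1
    ... | no  _ = 0

    δ-≡1 : ∀ {u x} → u ≡ x [mod M ] → δ u x ≡ 1
    δ-≡1 {u} {x} u≡x with u ≟ x [mod M ]
    ... | yes _  = refl
    ... | no u≢x = ⊥-elim (u≢x u≡x)

    δ-≡0 : ∀ {u x} → ¬ u ≡ x [mod M ] → δ u x ≡ 0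
    δ-≡0 {u} {x} u≢x with u ≟ x [mod M ]
    ... | yes u≡x = ⊥-elim (u≢x u≡x)
    ... | no _    = refl

  δ-cong-⇔ : ∀ {u x u′ x′} → (u ≡ x [mod M ] → u′ ≡ x′ [mod M ]) → (u′ ≡ x′ [mod M ] → u ≡ x [mod M ]) →
             δ u x ≡ δ u′ x′
  δ-cong-⇔ {u} {x} {u′} {x′} to from = by-cases (u ≟ x [mod M ])
    where
    by-cases : Dec (u ≡ x [mod M ]) → δ u x ≡ δ u′ x′
    by-cases (yes u≡x) = trans (δ-≡1 u≡x) (sym (δ-≡1 (to u≡x)))
    by-cases (no u≢x)  = trans (δ-≡0 u≢x) (sym (δ-≡0 (u≢x ∘ from)))

  δ-cong : ∀ {u u′ x x′} → u ≡ u′ [mod M ] → x ≡ x′ [mod M ] → δ u x ≡ δ u′ x′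
  δ-cong u≡u′ x≡x′ = δ-cong-⇔
    (λ u≡x → ≡mod-trans (≡mod-sym u≡u′) (≡mod-trans u≡x x≡x′))
    (λ u′≡x′ → ≡mod-trans u≡u′ (≡mod-trans u′≡x′ (≡mod-sym x≡x′)))

  δ-sym : ∀ u x → δ u x ≡ δ x u
  δ-sym u x = δ-cong-⇔ ≡mod-sym ≡mod-sym

  δ-+-cancelˡ : ∀ y z c → δ (y + z) (y + c) ≡ δ z c
  δ-+-cancelˡ y z c = δ-cong-⇔ (≡mod-+-cancelˡ y) (≡mod-+ ≡mod-refl)

  ∑-δ : ∀ u (g : Fn) → ∑< M (λ w → δ u w * g w) ≡ g (u % M)
  ∑-δ u g = trans (∑<-pick M {λ w → δ u w * g w} (u % M) (m%n<n u M) off)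
    (trans (cong (_* g (u % M)) (δ-≡1 (≡mod-sym (%≡mod M u)))) (+-identityʳ _))
    where
    off : ∀ w → w < M → w ≢ u % M → δ u w * g w ≡ 0
    off w w<M w≢ = cong (_* g w) (δ-≡0 λ u≡w → w≢ (trans (sym (m<n⇒m%n≡m w<M)) (sym (≡mod⇒%≡% M u≡w))))

  ∑-δ-resp : ∀ u (g : Fn) → (∀ {a b} → a ≡ b [mod M ] → g a ≡ g b) → ∑< M (λ w → δ u w * g w) ≡ g u
  ∑-δ-resp u g g-resp = trans (∑-δ u g) (g-resp (%≡mod M u))

  ∑-δ≡1 : ∀ u → ∑< M (δ u) ≡ 1
  ∑-δ≡1 u = trans (∑<-cong-≗ M (λ w → sym (*-identityʳ (δ u w)))) (∑-δ u (λ _ → 1))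

  ∑-δ-+≡1 : ∀ y x → ∑< M (λ z → δ (y + z) x) ≡ 1
  ∑-δ-+≡1 y x with c , y+c≡x ← ≡mod-difference M x y = begin
    ∑< M (λ z → δ (y + z) x)       ≡⟨ ∑<-cong-≗ M (λ z → δ-cong ≡mod-refl (≡mod-sym y+c≡x)) ⟩
    ∑< M (λ z → δ (y + z) (y + c)) ≡⟨ ∑<-cong-≗ M (λ z → trans (δ-+-cancelˡ y z c) (δ-sym z c)) ⟩
    ∑< M (δ c)                     ≡⟨ ∑-δ≡1 c ⟩
    1                              ∎

  infixl 7 _⋆_
  _⋆_ : Fn → Fn → Fn
  (f ⋆ g) x = ∑< M λ y → ∑< M λ z → f y * g z * δ (y + z) x

  infixl 6 _⊕_
  _⊕_ : Fn → Fn → Fn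
  (f ⊕ g) x = f x + g x

  0ᶠ : Fn
  0ᶠ _ = 0

  ⋆-cong : ∀ {f f′ g g′} → f ≈ f′ → g ≈ g′ → ∀ x → (f ⋆ g) x ≡ (f′ ⋆ g′) x
  ⋆-cong f≈f′ g≈g′ x = ∑<-cong M λ y y<M → ∑<-cong M λ z z<M →
    cong₂ (λ a b → a * b * δ (y + z) x) (f≈f′ y y<M) (g≈g′ z z<M)

  ⋆-comm : ∀ f g x → (f ⋆ g) x ≡ (g ⋆ f) x
  ⋆-comm f g x = trans (∑<-comm M M _) (∑<-cong-≗ M λ z → ∑<-cong-≗ M λ y →
    cong₂ _*_ (*-comm (f y) (g z)) (cong (λ t → δ t x) (+-comm y z)))

  ⋆-identityˡ : ∀ f → δ 0 ⋆ f ≈ f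
  ⋆-identityˡ f x x<M = begin
    (δ 0 ⋆ f) x
      ≡⟨ ∑<-cong-≗ M (λ y → trans (∑<-cong-≗ M λ z → *-assoc (δ 0 y) (f z) _)
                                  (sym (*-distribˡ-∑< M (δ 0 y) (λ z → f z * δ (y + z) x)))) ⟩
    ∑< M (λ y → δ 0 y * ∑< M (λ z → f z * δ (y + z) x))
      ≡⟨ ∑-δ-resp 0 (λ y → ∑< M (λ z → f z * δ (y + z) x))
           (λ a≡b → ∑<-cong-≗ M λ z → cong (f z *_) (δ-cong (≡mod-+ a≡b ≡mod-refl) ≡mod-refl)) ⟩
    ∑< M (λ z → f z * δ z x)
      ≡⟨ ∑<-cong-≗ M (λ z → trans (*-comm (f z) _) (cong (_* f z) (δ-sym z x))) ⟩
    ∑< M (λ z → δ x z * f z)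
      ≡⟨ ∑-δ x f ⟩
    f (x % M)
      ≡⟨ cong f (m<n⇒m%n≡m x<M) ⟩
    f x ∎

  ⋆-distribˡ-⊕ : ∀ f g h x → (f ⋆ (g ⊕ h)) x ≡ (f ⋆ g) x + (f ⋆ h) x
  ⋆-distribˡ-⊕ f g h x = trans
    (∑<-cong-≗ M λ y → trans (∑<-cong-≗ M λ z → distrib y z) (∑<-distrib-+ M (term g y) (term h y)))
    (∑<-distrib-+ M (λ y → ∑< M (term g y)) (λ y → ∑< M (term h y)))
    where
    term : Fn → ℕ → ℕ → ℕ
    term k y z = f y * k z * δ (y + z) x
    distrib : ∀ y z → term (g ⊕ h) y z ≡ term g y z + term h y z
    distrib y z = trans (cong (_* δ (y + z) x) (*-distribˡ-+ (f y) (g z) (h z)))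
                        (*-distribʳ-+ (δ (y + z) x) (f y * g z) (f y * h z))

  ⋆-zeroˡ : ∀ f x → (0ᶠ ⋆ f) x ≡ 0
  ⋆-zeroˡ f x = ∑<-zero M λ _ _ → ∑<-zero M λ _ _ → refl

  triple : Fn → Fn → Fn → Fn
  triple f g h x = ∑< M λ y → ∑< M λ z → ∑< M λ t → f y * g z * h t * δ (y + z + t) x

  ⋆ˡ-triple : ∀ f g h x → ((f ⋆ g) ⋆ h) x ≡ triple f g h x
  ⋆ˡ-triple f g h x = begin
    ((f ⋆ g) ⋆ h) x
      ≡⟨ ∑<-cong-≗ M (λ w → ∑<-cong-≗ M λ t → expand w t) ⟩
    (∑< M λ w → ∑< M λ t → ∑< M λ y → ∑< M λ z → X w t y z)
      ≡⟨ ∑<-comm M M (λ w t → ∑< M λ y → ∑< M λ z → X w t y z) ⟩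
    (∑< M λ t → ∑< M λ w → ∑< M λ y → ∑< M λ z → X w t y z)
      ≡⟨ ∑<-cong-≗ M (λ t → trans (∑<-comm M M _) (∑<-cong-≗ M λ y → ∑<-comm M M _)) ⟩
    (∑< M λ t → ∑< M λ y → ∑< M λ z → ∑< M λ w → X w t y z)
      ≡⟨ ∑<-comm M M _ ⟩
    (∑< M λ y → ∑< M λ t → ∑< M λ z → ∑< M λ w → X w t y z)
      ≡⟨ ∑<-cong-≗ M (λ y → ∑<-comm M M _) ⟩
    (∑< M λ y → ∑< M λ z → ∑< M λ t → ∑< M λ w → X w t y z)
      ≡⟨ ∑<-cong-≗ M (λ y → ∑<-cong-≗ M λ z → ∑<-cong-≗ M λ t → collapse y z t) ⟩
    triple f g h x ∎
    where
    X : ℕ → ℕ → ℕ → ℕ → ℕ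
    X w t y z = f y * g z * δ (y + z) w * (h t * δ (w + t) x)
    expand : ∀ w t → (f ⋆ g) w * h t * δ (w + t) x ≡ ∑< M λ y → ∑< M λ z → X w t y z
    expand w t = trans (*-assoc ((f ⋆ g) w) (h t) (δ (w + t) x))
      (trans (*-distribʳ-∑< M _ (λ y → ∑< M λ z → f y * g z * δ (y + z) w))
             (∑<-cong-≗ M λ y → *-distribʳ-∑< M _ (λ z → f y * g z * δ (y + z) w)))
    rearrange : ∀ a b c d e → a * b * c * (d * e) ≡ c * (a * (b * (d * e)))
    rearrange = solve-∀
    reassociate : ∀ a b c d → a * (b * (c * d)) ≡ a * b * c * d
    reassociate = solve-∀
    collapse : ∀ y z t → ∑< M (λ w → X w t y z) ≡ f y * g z * h t * δ (y + z + t) x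
    collapse y z t = begin
      ∑< M (λ w → X w t y z)
        ≡⟨ ∑<-cong-≗ M (λ w → rearrange (f y) (g z) (δ (y + z) w) (h t) (δ (w + t) x)) ⟩
      ∑< M (λ w → δ (y + z) w * (f y * (g z * (h t * δ (w + t) x))))
        ≡⟨ ∑-δ-resp (y + z) _ (λ a≡b → cong (λ v → f y * (g z * (h t * v))) (δ-cong (≡mod-+ a≡b ≡mod-refl) ≡mod-refl)) ⟩
      f y * (g z * (h t * δ (y + z + t) x))
        ≡⟨ reassociate (f y) (g z) (h t) (δ (y + z + t) x) ⟩
      f y * g z * h t * δ (y + z + t) x ∎

  triple-rotate : ∀ f g h x → triple g h f x ≡ triple f g h x
  triple-rotate f g h x = begin
    triple g h f x
      ≡⟨ ∑<-cong-≗ M (λ z → ∑<-comm M M _) ⟩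
    (∑< M λ z → ∑< M λ y → ∑< M λ t → g z * h t * f y * δ (z + t + y) x)
      ≡⟨ ∑<-comm M M _ ⟩
    (∑< M λ y → ∑< M λ z → ∑< M λ t → g z * h t * f y * δ (z + t + y) x)
      ≡⟨ ∑<-cong-≗ M (λ y → ∑<-cong-≗ M λ z → ∑<-cong-≗ M λ t →
           cong₂ _*_ (rotate-* (g z) (h t) (f y)) (cong (λ v → δ v x) (rotate-+ z t y))) ⟩
    triple f g h x ∎
    where
    rotate-* : ∀ a b c → a * b * c ≡ c * a * b
    rotate-* = solve-∀
    rotate-+ : ∀ a b c → a + b + c ≡ c + a + b
    rotate-+ = solve-∀

  ⋆-assoc : ∀ f g h x → ((f ⋆ g) ⋆ h) x ≡ (f ⋆ (g ⋆ h)) x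
  ⋆-assoc f g h x = begin
    ((f ⋆ g) ⋆ h) x ≡⟨ ⋆ˡ-triple f g h x ⟩
    triple f g h x  ≡⟨ triple-rotate f g h x ⟨
    triple g h f x  ≡⟨ ⋆ˡ-triple g h f x ⟨
    ((g ⋆ h) ⋆ f) x ≡⟨ ⋆-comm (g ⋆ h) f x ⟩
    (f ⋆ (g ⋆ h)) x ∎

  semiring : Semiring 0ℓ 0ℓ
  semiring = record
    { Carrier = Fn ; _≈_ = _≈_ ; _+_ = _⊕_ ; _*_ = _⋆_ ; 0# = 0ᶠ ; 1# = δ 0
    ; isSemiring = record
      { isSemiringWithoutAnnihilatingZero = record
        { +-isCommutativeMonoid = record
          { isMonoid = record
            { isSemigroup = record
              { isMagma = record
                { isEquivalence = record
                  { refl = λ _ _ → refl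
                  ; sym = λ f≈g x x<M → sym (f≈g x x<M)
                  ; trans = λ f≈g g≈h x x<M → trans (f≈g x x<M) (g≈h x x<M) }
                ; ∙-cong = λ f≈f′ g≈g′ x x<M → cong₂ _+_ (f≈f′ x x<M) (g≈g′ x x<M) }
              ; assoc = λ f g h x _ → +-assoc (f x) (g x) (h x) }
            ; identity = (λ _ _ _ → refl) , (λ f x _ → +-identityʳ (f x)) }
          ; comm = λ f g x _ → +-comm (f x) (g x) }
        ; *-cong = λ f≈f′ g≈g′ x _ → ⋆-cong f≈f′ g≈g′ x
        ; *-assoc = λ f g h x _ → ⋆-assoc f g h x
        ; *-identity = ⋆-identityˡ , λ f x x<M → trans (⋆-comm f (δ 0) x) (⋆-identityˡ f x x<M)
        ; distrib = (λ f g h x _ → ⋆-distribˡ-⊕ f g h x)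
                  , (λ f g h x _ → trans (⋆-comm (g ⊕ h) f x) (trans (⋆-distribˡ-⊕ f g h x)
                       (cong₂ _+_ (⋆-comm f g x) (⋆-comm f h x)))) }
      ; zero = (λ f x _ → ⋆-zeroˡ f x) , (λ f x _ → trans (⋆-comm f 0ᶠ x) (⋆-zeroˡ f x)) } }

  open import Algebra.Properties.Semiring.Exp semiring public using () renaming (_^_ to _^ᶠ_)

  mass : Fn → ℕ
  mass = ∑< M

  mass-⋆ : ∀ f g → mass (f ⋆ g) ≡ mass f * mass g
  mass-⋆ f g = begin
    mass (f ⋆ g)
      ≡⟨ ∑<-comm M M _ ⟩
    (∑< M λ y → ∑< M λ x → ∑< M λ z → f y * g z * δ (y + z) x)
      ≡⟨ ∑<-cong-≗ M (λ y → ∑<-comm M M _) ⟩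
    (∑< M λ y → ∑< M λ z → ∑< M λ x → f y * g z * δ (y + z) x)
      ≡⟨ ∑<-cong-≗ M (λ y → ∑<-cong-≗ M λ z → trans (sym (*-distribˡ-∑< M (f y * g z) (δ (y + z))))
           (trans (cong (f y * g z *_) (∑-δ≡1 (y + z))) (*-identityʳ _))) ⟩
    (∑< M λ y → ∑< M λ z → f y * g z)
      ≡⟨ ∑<-cong-≗ M (λ y → sym (*-distribˡ-∑< M (f y) g)) ⟩
    (∑< M λ y → f y * mass g)
      ≡⟨ *-distribʳ-∑< M (mass g) f ⟨
    mass f * mass g ∎

  mass-^ᶠ : ∀ f n → mass (f ^ᶠ n) ≡ mass f ^ n
  mass-^ᶠ f zero    = ∑-δ≡1 0
  mass-^ᶠ f (suc n) = trans (mass-⋆ f (f ^ᶠ n)) (cong (mass f *_) (mass-^ᶠ f n))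

  𝟙 : Fn
  𝟙 _ = 1

  mass-𝟙 : mass 𝟙 ≡ M
  mass-𝟙 = trans (∑<-const M 1) (*-identityʳ M)

  ⋆-𝟙 : ∀ f x → (f ⋆ 𝟙) x ≡ mass f
  ⋆-𝟙 f x = ∑<-cong-≗ M λ y → begin
    ∑< M (λ z → f y * 1 * δ (y + z) x) ≡⟨ ∑<-cong-≗ M (λ z → cong (_* δ (y + z) x) (*-identityʳ (f y))) ⟩
    ∑< M (λ z → f y * δ (y + z) x)     ≡⟨ *-distribˡ-∑< M (f y) (λ z → δ (y + z) x) ⟨
    f y * ∑< M (λ z → δ (y + z) x)     ≡⟨ cong (f y *_) (∑-δ-+≡1 y x) ⟩
    f y * 1                            ≡⟨ *-identityʳ (f y) ⟩
    f y                                ∎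

  ⋆-cong-≡mod : ∀ {q f f′} g → (∀ y → y < M → f y ≡ f′ y [mod q ]) → ∀ x → (f ⋆ g) x ≡ (f′ ⋆ g) x [mod q ]
  ⋆-cong-≡mod g f≡f′ x = ∑<-cong-≡mod M λ y y<M → ∑<-cong-≡mod M λ z _ →
    ≡mod-*ʳ (δ (y + z) x) (≡mod-*ʳ (g z) (f≡f′ y y<M))

  -- The push-forward of f along w ↦ r w: the mask polynomial F(X^r).
  dilate : ℕ → Fn → Fn
  dilate r f y = ∑< M λ w → f w * δ (r * w) y

  mass-dilate : ∀ r f → mass (dilate r f) ≡ mass f
  mass-dilate r f = trans (∑<-comm M M _) (∑<-cong-≗ M λ w →
    trans (sym (*-distribˡ-∑< M (f w) (δ (r * w)))) (trans (cong (f w *_) (∑-δ≡1 (r * w))) (*-identityʳ (f w))))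

  dilate-1 : ∀ f → dilate 1 f ≈ f
  dilate-1 f y y<M = begin
    dilate 1 f y
      ≡⟨ ∑<-cong-≗ M (λ w → trans (*-comm (f w) _) (cong (_* f w) (trans (cong (λ v → δ v y) (*-identityˡ w)) (δ-sym w y)))) ⟩
    ∑< M (λ w → δ y w * f w)  ≡⟨ ∑-δ y f ⟩
    f (y % M)                 ≡⟨ cong f (m<n⇒m%n≡m y<M) ⟩
    f y                       ∎

  dilate-* : ∀ q r f y → dilate (q * r) f y ≡ dilate q (dilate r f) y
  dilate-* q r f y = sym (begin
    dilate q (dilate r f) y
      ≡⟨ ∑<-cong-≗ M (λ w → *-distribʳ-∑< M (δ (q * w) y) (λ v → f v * δ (r * v) w)) ⟩
    (∑< M λ w → ∑< M λ v → f v * δ (r * v) w * δ (q * w) y)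
      ≡⟨ ∑<-comm M M _ ⟩
    (∑< M λ v → ∑< M λ w → f v * δ (r * v) w * δ (q * w) y)
      ≡⟨ ∑<-cong-≗ M (λ v → ∑<-cong-≗ M λ w → rearrange (f v) (δ (r * v) w) (δ (q * w) y)) ⟩
    (∑< M λ v → ∑< M λ w → δ (r * v) w * (f v * δ (q * w) y))
      ≡⟨ ∑<-cong-≗ M (λ v → ∑-δ-resp (r * v) _ λ a≡b → cong (f v *_) (δ-cong (≡mod-*ˡ q a≡b) ≡mod-refl)) ⟩
    (∑< M λ v → f v * δ (q * (r * v)) y)
      ≡⟨ ∑<-cong-≗ M (λ v → cong (λ u → f v * δ u y) (sym (*-assoc q r v))) ⟩
    dilate (q * r) f y ∎)
    where
    rearrange : ∀ a b c → a * b * c ≡ b * (a * c)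
    rearrange = solve-∀

  dilate-⋆ : ∀ r f g x → (dilate r f ⋆ g) x ≡ ∑< M λ w → ∑< M λ z → f w * g z * δ (r * w + z) x
  dilate-⋆ r f g x = begin
    (dilate r f ⋆ g) x
      ≡⟨ ∑<-cong-≗ M (λ y → ∑<-cong-≗ M λ z → trans (*-assoc (dilate r f y) (g z) _)
           (*-distribʳ-∑< M (g z * δ (y + z) x) (λ w → f w * δ (r * w) y))) ⟩
    (∑< M λ y → ∑< M λ z → ∑< M λ w → f w * δ (r * w) y * (g z * δ (y + z) x))
      ≡⟨ ∑<-cong-≗ M (λ y → ∑<-comm M M _) ⟩
    (∑< M λ y → ∑< M λ w → ∑< M λ z → f w * δ (r * w) y * (g z * δ (y + z) x))
      ≡⟨ ∑<-comm M M _ ⟩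
    (∑< M λ w → ∑< M λ y → ∑< M λ z → f w * δ (r * w) y * (g z * δ (y + z) x))
      ≡⟨ ∑<-cong-≗ M (λ w → ∑<-comm M M _) ⟩
    (∑< M λ w → ∑< M λ z → ∑< M λ y → f w * δ (r * w) y * (g z * δ (y + z) x))
      ≡⟨ ∑<-cong-≗ M (λ w → ∑<-cong-≗ M λ z → trans
           (∑<-cong-≗ M λ y → rearrange (f w) (δ (r * w) y) (g z) (δ (y + z) x))
           (∑-δ-resp (r * w) _ λ a≡b → cong (f w * g z *_) (δ-cong (≡mod-+ a≡b ≡mod-refl) ≡mod-refl))) ⟩
    (∑< M λ w → ∑< M λ z → f w * g z * δ (r * w + z) x) ∎
    where
    rearrange : ∀ a b c d → a * b * (c * d) ≡ b * (a * c * d)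
    rearrange = solve-∀


-- Frobenius and Tijdeman's theorem

module Frobenius (M : ℕ) .{{_ : NonZero M}} where
  open GroupSemiring M
  open import Algebra.Properties.Semiring.Mult semiring using () renaming (_×_ to _×ᶠ_)
  open import Algebra.Properties.Semiring.Sum semiring using () renaming (sum to ∑ᶠ)
  open import Algebra.Properties.Semiring.Exp semiring using (^-congˡ)

  ×ᶠ-eval : ∀ n f x → (n ×ᶠ f) x ≡ n * f x
  ×ᶠ-eval zero    f x = refl
  ×ᶠ-eval (suc n) f x = cong (f x +_) (×ᶠ-eval n f x)

  ∑ᶠ-eval : ∀ {n} (t : Fin n → Fn) x → ∑ᶠ t x ≡ ∑[ i < n ] t i x
  ∑ᶠ-eval {zero}  t x = refl
  ∑ᶠ-eval {suc n} t x = cong (t zero x +_) (∑ᶠ-eval (t ∘ suc) x)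

  ⊕-^ᶠ-prime : ∀ {q} → Prime q → ∀ f g x → x < M → ((f ⊕ g) ^ᶠ q) x ≡ (f ^ᶠ q) x + (g ^ᶠ q) x [mod q ]
  ⊕-^ᶠ-prime {q@(suc q′)} pq f g x x<M = begin
    ((f ⊕ g) ^ᶠ q) x              ≡⟨ expansion ⟩
    T 0 + ∑< q′ (T ∘ suc) + T q   ≈⟨ ≡mod-+ (≡mod-+ (≡mod-refl {x = T 0}) middle≡0) (≡mod-refl {x = T q}) ⟩
    T 0 + 0 + T q                 ≡⟨ cong₂ _+_ (trans (+-identityʳ (T 0)) T0≡) Tq≡ ⟩
    (g ^ᶠ q) x + (f ^ᶠ q) x       ≡⟨ +-comm ((g ^ᶠ q) x) ((f ^ᶠ q) x) ⟩
    (f ^ᶠ q) x + (g ^ᶠ q) x       ∎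
    where
    open import Relation.Binary.Reasoning.Setoid (≡mod-setoid q)
    T : ℕ → ℕ
    T k = (q C k) * (f ^ᶠ k ⋆ g ^ᶠ (q ∸ k)) x
    expansion : ((f ⊕ g) ^ᶠ q) x ≡ T 0 + ∑< q′ (T ∘ suc) + T q
    expansion = ≡.begin
      ((f ⊕ g) ^ᶠ q) x
        ≡.≡⟨ Binomial.theorem semiring f g (λ y _ → ⋆-comm f g y) q x x<M ⟩
      ∑ᶠ (Binomial.binomialTerm semiring f g q) x
        ≡.≡⟨ ∑ᶠ-eval (Binomial.binomialTerm semiring f g q) x ⟩
      ∑[ k < suc q ] Binomial.binomialTerm semiring f g q k x
        ≡.≡⟨ sum-cong-≗ {suc q} {λ k → Binomial.binomialTerm semiring f g q k x} {T ∘ toℕ}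
               (λ k → ×ᶠ-eval (q C toℕ k) (f ^ᶠ toℕ k ⋆ g ^ᶠ (q ∸ toℕ k)) x) ⟩
      ∑[ k < suc q ] T (toℕ k)
        ≡.≡⟨ sum≡∑< (suc q) T ⟩
      ∑< (suc q) T
        ≡.≡⟨ ∑<-suc q T ⟩
      T 0 + ∑< q (T ∘ suc)
        ≡.≡⟨ cong (T 0 +_) (∑<-sucʳ q′ (T ∘ suc)) ⟩
      T 0 + (∑< q′ (T ∘ suc) + T q)
        ≡.≡⟨ +-assoc (T 0) _ (T q) ⟨
      T 0 + ∑< q′ (T ∘ suc) + T q ≡.∎
      where module ≡ = ≡-Reasoning
    middle≡0 : ∑< q′ (T ∘ suc) ≡ 0 [mod q ]
    middle≡0 = ≡mod-trans (∑<-cong-≡mod q′ (λ k k<q′ → ∣⇒≡0 (∣m⇒∣m*n _ (prime∣C pq z<s (s<s k<q′)))))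
                          (≡mod-reflexive (∑<-zero q′ λ _ _ → refl))
    T0≡ : T 0 ≡ (g ^ᶠ q) x
    T0≡ = trans (+-identityʳ _) (⋆-identityˡ (g ^ᶠ q) x x<M)
    Tq≡ : T q ≡ (f ^ᶠ q) x
    Tq≡ = ≡.begin
      (q C q) * (f ^ᶠ q ⋆ g ^ᶠ (q ∸ q)) x ≡.≡⟨ cong₂ (λ c k → c * (f ^ᶠ q ⋆ g ^ᶠ k) x) (nCn≡1 q) (n∸n≡0 q) ⟩
      1 * (f ^ᶠ q ⋆ δ 0) x                ≡.≡⟨ *-identityˡ _ ⟩
      (f ^ᶠ q ⋆ δ 0) x                    ≡.≡⟨ ⋆-comm (f ^ᶠ q) (δ 0) x ⟩
      (δ 0 ⋆ f ^ᶠ q) x                    ≡.≡⟨ ⋆-identityˡ (f ^ᶠ q) x x<M ⟩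
      (f ^ᶠ q) x                          ≡.∎
      where module ≡ = ≡-Reasoning

  δ-⋆-δ : ∀ a b x → (δ a ⋆ δ b) x ≡ δ (a + b) x
  δ-⋆-δ a b x = begin
    (δ a ⋆ δ b) x
      ≡⟨ ∑<-cong-≗ M (λ y → trans (∑<-cong-≗ M λ z → *-assoc (δ a y) (δ b z) _) (sym (*-distribˡ-∑< M (δ a y) _))) ⟩
    ∑< M (λ y → δ a y * ∑< M (λ z → δ b z * δ (y + z) x))
      ≡⟨ ∑-δ-resp a _ (λ a≡b → ∑<-cong-≗ M λ z → cong (δ b z *_) (δ-cong (≡mod-+ a≡b ≡mod-refl) ≡mod-refl)) ⟩
    ∑< M (λ z → δ b z * δ (a + z) x)
      ≡⟨ ∑-δ-resp b _ (λ a≡b → δ-cong (≡mod-+ ≡mod-refl a≡b) ≡mod-refl) ⟩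
    δ (a + b) x ∎
    where open ≡-Reasoning

  δ-^ᶠ : ∀ n c x → x < M → (δ c ^ᶠ n) x ≡ δ (n * c) x
  δ-^ᶠ zero    c x _   = refl
  δ-^ᶠ (suc n) c x x<M = trans (⋆-cong {δ c} (λ _ _ → refl) (λ y y<M → δ-^ᶠ n c y y<M) x) (δ-⋆-δ c (n * c) x)

  Σδ : List ℕ → Fn
  Σδ []       = 0ᶠ
  Σδ (c ∷ cs) = δ c ⊕ Σδ cs

  Σδ-^ᶠ-prime : ∀ {q} → Prime q → ∀ cs x → x < M → (Σδ cs ^ᶠ q) x ≡ Σδ (map (q *_) cs) x [mod q ]
  Σδ-^ᶠ-prime {suc q′} _ []       x _   = ≡mod-reflexive (⋆-zeroˡ (0ᶠ ^ᶠ q′) x)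
  Σδ-^ᶠ-prime {q}      pq (c ∷ cs) x x<M = ≡mod-trans (⊕-^ᶠ-prime pq (δ c) (Σδ cs) x x<M)
    (≡mod-+ (≡mod-reflexive (δ-^ᶠ q c x x<M)) (Σδ-^ᶠ-prime pq cs x x<M))

  points : Fn → ℕ → List ℕ
  points F zero    = []
  points F (suc n) = replicate (F 0) 0 ++ map suc (points (F ∘ suc) n)

  Σδ-replicate-++ : ∀ k c cs x → Σδ (replicate k c ++ cs) x ≡ k * δ c x + Σδ cs x
  Σδ-replicate-++ zero    c cs x = refl
  Σδ-replicate-++ (suc k) c cs x = trans (cong (δ c x +_) (Σδ-replicate-++ k c cs x)) (sym (+-assoc (δ c x) _ _))

  Σδ-map-points : ∀ (g : ℕ → ℕ) F n x → Σδ (map g (points F n)) x ≡ ∑< n (λ w → F w * δ (g w) x)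
  Σδ-map-points g F zero    x = sym (∑<-zero 0 λ _ ())
  Σδ-map-points g F (suc n) x = begin
    Σδ (map g (replicate (F 0) 0 ++ map suc (points (F ∘ suc) n))) x
      ≡⟨ cong (λ cs → Σδ cs x) (trans (map-++ g (replicate (F 0) 0) _)
           (cong₂ _++_ (map-replicate g (F 0) 0) (sym (map-∘ (points (F ∘ suc) n))))) ⟩
    Σδ (replicate (F 0) (g 0) ++ map (g ∘ suc) (points (F ∘ suc) n)) x
      ≡⟨ Σδ-replicate-++ (F 0) (g 0) _ x ⟩
    F 0 * δ (g 0) x + Σδ (map (g ∘ suc) (points (F ∘ suc) n)) x
      ≡⟨ cong (F 0 * δ (g 0) x +_) (Σδ-map-points (g ∘ suc) (F ∘ suc) n x) ⟩
    F 0 * δ (g 0) x + ∑< n (λ w → F (suc w) * δ (g (suc w)) x)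
      ≡⟨ ∑<-suc n (λ w → F w * δ (g w) x) ⟨
    ∑< (suc n) (λ w → F w * δ (g w) x) ∎
    where open ≡-Reasoning

  frobenius : ∀ {q} → Prime q → ∀ F x → x < M → (F ^ᶠ q) x ≡ dilate q F x [mod q ]
  frobenius {q} pq F x x<M = begin
    (F ^ᶠ q) x                           ≡⟨ ^-congˡ q F≈Σδ x x<M ⟩
    (Σδ (points F M) ^ᶠ q) x             ≈⟨ Σδ-^ᶠ-prime pq (points F M) x x<M ⟩
    Σδ (map (q *_) (points F M)) x       ≡⟨ Σδ-map-points (q *_) F M x ⟩
    dilate q F x                         ∎
    where
    open import Relation.Binary.Reasoning.Setoid (≡mod-setoid q)
    F≈Σδ : F ≈ Σδ (points F M)
    F≈Σδ y y<M = sym (trans (cong (λ cs → Σδ cs y) (sym (trans (map-cong *-identityˡ (points F M)) (map-id (points F M)))))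
                            (trans (Σδ-map-points (1 *_) F M y) (dilate-1 F y y<M)))


module Tijdeman (M : ℕ) .{{_ : NonZero M}} where
  open GroupSemiring M
  open Frobenius M

  -- By Frobenius, N := dilate q F ⋆ G is ≡ F^q ⋆ G = (mass F)^(q−1) · 𝟙, which is nonzero modulo q;
  -- so N ≥ 1 everywhere, and as its mass is M, N ≈ 𝟙.
  dilate-prime : ∀ {q} → Prime q → ¬ q ∣ M → ∀ F G → F ⋆ G ≈ 𝟙 → dilate q F ⋆ G ≈ 𝟙
  dilate-prime {q@(suc q′)} pq q∤M F G F⋆G≈𝟙 = ∑<-≡length⇒all-one M N N-positive massN≡M
    where
    open ≡-Reasoning
    N : Fn
    N = dilate q F ⋆ G
    massF*massG≡M : mass F * mass G ≡ M
    massF*massG≡M = trans (sym (mass-⋆ F G)) (trans (∑<-cong M F⋆G≈𝟙) mass-𝟙)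
    F^q⋆G≡ : ∀ x → x < M → (F ^ᶠ q ⋆ G) x ≡ mass F ^ q′
    F^q⋆G≡ x x<M = begin
      (F ⋆ F ^ᶠ q′ ⋆ G) x   ≡⟨ ⋆-cong {g = G} (λ y _ → ⋆-comm F (F ^ᶠ q′) y) (λ _ _ → refl) x ⟩
      (F ^ᶠ q′ ⋆ F ⋆ G) x   ≡⟨ ⋆-assoc (F ^ᶠ q′) F G x ⟩
      (F ^ᶠ q′ ⋆ (F ⋆ G)) x ≡⟨ ⋆-cong {F ^ᶠ q′} (λ _ _ → refl) F⋆G≈𝟙 x ⟩
      (F ^ᶠ q′ ⋆ 𝟙) x       ≡⟨ ⋆-𝟙 (F ^ᶠ q′) x ⟩
      mass (F ^ᶠ q′)        ≡⟨ mass-^ᶠ F q′ ⟩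
      mass F ^ q′           ∎
    N≡ : ∀ x → x < M → mass F ^ q′ ≡ N x [mod q ]
    N≡ x x<M = subst (_≡ N x [mod q ]) (F^q⋆G≡ x x<M) (⋆-cong-≡mod G (frobenius pq F) x)
    N-positive : ∀ x → x < M → 1 ≤ N x
    N-positive x x<M = n≢0⇒n>0 λ Nx≡0 → q∤M (∣-trans
      (prime∣^⇒∣ pq (mass F) q′ (≡0⇒∣ (subst (mass F ^ q′ ≡_[mod q ]) Nx≡0 (N≡ x x<M))))
      (divides (mass G) (trans (sym massF*massG≡M) (*-comm (mass F) (mass G)))))
    massN≡M : mass N ≡ M
    massN≡M = trans (mass-⋆ (dilate q F) G) (trans (cong (_* mass G) (mass-dilate q F)) massF*massG≡M)

  dilate-product : ∀ {qs} → All Prime qs → (∀ {q} → q ∈ qs → ¬ q ∣ M) →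
                   ∀ F G → F ⋆ G ≈ 𝟙 → dilate (product qs) F ⋆ G ≈ 𝟙
  dilate-product All.[] _ F G F⋆G≈𝟙 x x<M =
    trans (⋆-cong {g = G} (dilate-1 F) (λ _ _ → refl) x) (F⋆G≈𝟙 x x<M)
  dilate-product {q ∷ qs} (pq All.∷ pqs) ∉M F G F⋆G≈𝟙 x x<M = trans
    (⋆-cong {dilate (q * product qs) F} {dilate q (dilate (product qs) F)} {G}
            (λ y _ → dilate-* q (product qs) F y) (λ _ _ → refl) x)
    (dilate-prime pq (∉M (here refl)) (dilate (product qs) F) G
                  (dilate-product pqs (∉M ∘ there) F G F⋆G≈𝟙) x x<M)

  tijdeman : ∀ r .{{_ : NonZero r}} → NoCommonPrimeFactor r M → ∀ F G → F ⋆ G ≈ 𝟙 → dilate r F ⋆ G ≈ 𝟙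
  tijdeman r r⊥M F G F⋆G≈𝟙 x x<M =
    trans (⋆-cong {dilate r F} {dilate (product factors) F} {G}
                  (λ y _ → cong (λ r → dilate r F y) isFactorisation) (λ _ _ → refl) x)
          (dilate-product factorsPrime factors⊥M F G F⋆G≈𝟙 x x<M)
    where
    open PrimeFactorisation (factorise r)
    factors⊥M : ∀ {q} → q ∈ factors → ¬ q ∣ M
    factors⊥M q∈ = r⊥M (lookup factorsPrime q∈) (subst (_ ∣_) (sym isFactorisation) (∈⇒∣product q∈))


-- Units modulo m

-- In the second Bézout case x u ≡ −1, so x (m − 1) inverts u.
inverse-mod : ∀ {u m} .{{_ : NonZero m}} → Coprime u m → ∃ λ i → i * u ≡ 1 [mod m ]
inverse-mod {u} {m@(suc m′)} u⊥m with coprime-Bézout u⊥m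
... | Bézout.+- x y 1+y*m≡x*u = x , 0 , y , trans (+-identityʳ (x * u)) (sym 1+y*m≡x*u)
... | Bézout.-+ x y 1+x*u≡y*m = x * m′ , y , x * u , (begin
  x * m′ * u + y * m     ≡⟨ cong (x * m′ * u +_) 1+x*u≡y*m ⟨
  x * m′ * u + (1 + x * u) ≡⟨ rearrange x m′ u ⟩
  1 + x * u * m          ∎)
  where
  open ≡-Reasoning
  rearrange : ∀ x m′ u → x * m′ * u + (1 + x * u) ≡ 1 + x * u * suc m′
  rearrange = solve-∀

prime-avoiding-shift : ∀ m .{{_ : NonZero m}} r₀ m′ .{{_ : NonZero m′}} → NoCommonPrimeFactor r₀ m′ →
                       ∃ λ t → NonZero (r₀ + m′ * t) × NoCommonPrimeFactor (r₀ + m′ * t) m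
prime-avoiding-shift m r₀ m′ r₀⊥m′ = t , r≢0 , r⊥m
  where
  open PrimeFactorisation (factorise m)
  ∤r₀? = λ q → ¬? (q ∣? r₀)
  t = product (filter ∤r₀? factors)
  t-primes = filter⁺ ∤r₀? factorsPrime
  instance _ = productOfPrimes≢0 t-primes
  r≢0 : NonZero (r₀ + m′ * t)
  r≢0 = >-nonZero (<-≤-trans (>-nonZero⁻¹ (m′ * t) {{m*n≢0 m′ t}}) (m≤n+m (m′ * t) r₀))
  -- A prime factor of m divides exactly one of r₀ and m′ * t.
  r⊥m : NoCommonPrimeFactor (r₀ + m′ * t) m
  r⊥m {q} pq q∣r q∣m with q ∣? r₀
  ... | yes q∣r₀ with euclidsLemma m′ t pq (∣m+n∣m⇒∣n q∣r q∣r₀)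
  ...   | inj₁ q∣m′ = r₀⊥m′ pq q∣r₀ q∣m′
  ...   | inj₂ q∣t  = proj₂ (∈-filter⁻ ∤r₀? {xs = factors} (factorisationHasAllPrimeFactors pq q∣t t-primes)) q∣r₀
  r⊥m {q} pq q∣r q∣m | no q∤r₀ = q∤r₀ (∣m+n∣m⇒∣n (subst (q ∣_) (+-comm r₀ (m′ * t)) q∣r) q∣m′*t)
    where
    q∣m′*t : q ∣ m′ * t
    q∣m′*t = ∣n⇒∣m*n m′ (∈⇒∣product (∈-filter⁺ ∤r₀?
      (factorisationHasAllPrimeFactors pq (subst (q ∣_) isFactorisation q∣m) factorsPrime) q∤r₀))

-- With d = gcd u m, write u = u′ d, v = v′ d and m = m′ d; then r₀ = u′⁻¹ v′ works modulo m′,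
-- and a shift by a multiple of m′ makes it prime to m.
unit-multiplier : ∀ m .{{_ : NonZero m}} u v →
                  (∀ {e} → e ∣ m → e ∣ u → e ∣ v) → (∀ {e} → e ∣ m → e ∣ v → e ∣ u) →
                  ∃ λ r → NonZero r × NoCommonPrimeFactor r m × r * u ≡ v [mod m ]
unit-multiplier m u v u⇒v v⇒u = r₀ + m′ * t , r≢0 , r⊥m , r*u≡v
  where
  d = gcd u m
  d∣u = gcd[m,n]∣m u m
  d∣m = gcd[m,n]∣n u m
  d∣v = u⇒v d∣m d∣u
  instance
    d≢0 : NonZero d
    d≢0 = ≢-nonZero (gcd[m,n]≢0 u m (inj₂ (≢-nonZero⁻¹ m)))
  u′ = quotient d∣u
  v′ = quotient d∣v
  m′ = quotient d∣m
  instance _ = quotient≢0 d∣m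
  m≡m′*d : m ≡ m′ * d
  m≡m′*d = m∣n⇒n≡quotient*m d∣m
  quotient-coprime : ∀ {w} (d∣w : d ∣ w) → (∀ {e} → e ∣ m → e ∣ w → e ∣ u) → Coprime (quotient d∣w) m′
  quotient-coprime {w} d∣w w⇒u {i} (i∣w′ , i∣m′) = ∣1⇒≡1 (*-cancelʳ-∣ d (subst (i * d ∣_) (sym (*-identityˡ d))
    (gcd-greatest (w⇒u i*d∣m (subst (i * d ∣_) (sym (m∣n⇒n≡quotient*m d∣w)) (*-monoˡ-∣ d i∣w′))) i*d∣m)))
    where
    i*d∣m : i * d ∣ m
    i*d∣m = subst (i * d ∣_) (sym m≡m′*d) (*-monoˡ-∣ d i∣m′)
  u′⊥m′ = quotient-coprime d∣u (λ _ e∣u → e∣u)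
  v′⊥m′ = quotient-coprime d∣v v⇒u
  i = proj₁ (inverse-mod u′⊥m′)
  i*u′≡1 = proj₂ (inverse-mod u′⊥m′)
  r₀ = i * v′
  r₀*u′≡v′ : r₀ * u′ ≡ v′ [mod m′ ]
  r₀*u′≡v′ = subst₂ _≡_[mod m′ ] (rearrange i u′ v′) (*-identityˡ v′) (≡mod-*ʳ v′ i*u′≡1)
    where
    rearrange : ∀ i u′ v′ → i * u′ * v′ ≡ i * v′ * u′
    rearrange = solve-∀
  r₀⊥m′ : NoCommonPrimeFactor r₀ m′
  r₀⊥m′ {q} pq q∣r₀ q∣m′ with euclidsLemma i v′ pq q∣r₀
  ... | inj₁ q∣i  = prime⇒∤1 pq (≡0⇒∣ (≡mod-trans (≡mod-sym (≡mod-∣ q∣m′ i*u′≡1)) (∣⇒≡0 (∣m⇒∣m*n u′ q∣i))))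
  ... | inj₂ q∣v′ = prime⇒∤1 pq (subst (q ∣_) (v′⊥m′ (q∣v′ , q∣m′)) ∣-refl)
  shift = prime-avoiding-shift m r₀ m′ r₀⊥m′
  t = proj₁ shift
  r≢0 = proj₁ (proj₂ shift)
  r⊥m = proj₂ (proj₂ shift)
  r*u≡v : (r₀ + m′ * t) * u ≡ v [mod m ]
  r*u≡v = begin
    (r₀ + m′ * t) * u                ≡⟨ cong ((r₀ + m′ * t) *_) (m∣n⇒n≡quotient*m d∣u) ⟩
    (r₀ + m′ * t) * (u′ * d)         ≡⟨ rearrange r₀ m′ t u′ d ⟩
    t * u′ * (m′ * d) + d * (r₀ * u′) ≡⟨ cong (λ k → t * u′ * k + d * (r₀ * u′)) m≡m′*d ⟨
    t * u′ * m + d * (r₀ * u′)       ≈⟨ [k*m+x]≡x (t * u′) (d * (r₀ * u′)) ⟩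
    d * (r₀ * u′)                    ≈⟨ subst (d * (r₀ * u′) ≡ d * v′ [mod_]) (trans (*-comm d m′) (sym m≡m′*d))
                                          (≡mod-scale d r₀*u′≡v′) ⟩
    d * v′                           ≡⟨ trans (*-comm d v′) (sym (m∣n⇒n≡quotient*m d∣v)) ⟩
    v                                ∎
    where
    open import Relation.Binary.Reasoning.Setoid (≡mod-setoid m)
    rearrange : ∀ r₀ m′ t u′ d → (r₀ + m′ * t) * (u′ * d) ≡ t * u′ * (m′ * d) + d * (r₀ * u′)
    rearrange = solve-∀


-- Sands' theorem

module TilingProperties (M : ℕ) .{{_ : NonZero M}} (A B : Subset) (tiling : Tiling M A B) where
  open GroupSemiring M
  open Tijdeman M

  A<M : ∀ {a} → A a → a < M
  A<M = proj₁ tiling _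

  B<M : ∀ {b} → B b → b < M
  B<M = proj₁ (proj₂ tiling) _

  cover : ∀ x → x < M → ∃[ a ] ∃[ b ] (A a × B b × a + b ≡ x [mod M ])
  cover x x<M with a , b , Aa , Bb , M∣ ← proj₁ (proj₂ (proj₂ tiling)) x x<M = a , b , Aa , Bb , ∣-∣⇒≡mod M∣

  unique : ∀ {a b a′ b′} → A a → B b → A a′ → B b′ → a + b ≡ a′ + b′ [mod M ] → a ≡ a′ × b ≡ b′
  unique Aa Bb Aa′ Bb′ eq = proj₂ (proj₂ (proj₂ tiling)) _ _ _ _ Aa Bb Aa′ Bb′ (≡mod⇒∣-∣ eq)

  some-tile : ∃[ a ] ∃[ b ] (A a × B b)
  some-tile with a , b , Aa , Bb , _ ← cover 0 (>-nonZero⁻¹ M) = a , b , Aa , Bb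

  -- y ∈ A iff y is the A-part of the tile covering y + b₀.
  A? : ∀ y → Dec (A y)
  A? y with some-tile
  ... | _ , b₀ , _ , B-b₀ with cover ((y + b₀) % M) (m%n<n (y + b₀) M)
  ...   | a , b , Aa , Bb , a+b≡ with a ≟ y
  ...     | yes refl = yes Aa
  ...     | no a≢y   = no λ Ay → a≢y (proj₁ (unique Aa Bb Ay B-b₀ (≡mod-trans a+b≡ (%≡mod M (y + b₀)))))

  B? : ∀ y → Dec (B y)
  B? y with some-tile
  ... | a₀ , _ , A-a₀ , _ with cover ((a₀ + y) % M) (m%n<n (a₀ + y) M)
  ...   | a , b , Aa , Bb , a+b≡ with b ≟ y
  ...     | yes refl = yes Bb
  ...     | no b≢y   = no λ By → b≢y (proj₂ (unique Aa Bb A-a₀ By (≡mod-trans a+b≡ (%≡mod M (a₀ + y)))))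

  𝟏A : Fn
  𝟏A y with A? y
  ... | yes _ = 1
  ... | no  _ = 0

  𝟏B : Fn
  𝟏B y with B? y
  ... | yes _ = 1
  ... | no  _ = 0

  pair-term≡1 : ∀ {y z u x} → A y → B z → u ≡ x [mod M ] → 𝟏A y * 𝟏B z * δ u x ≡ 1
  pair-term≡1 {y} {z} Ay Bz u≡x with A? y | B? z
  ... | yes _ | yes _ = trans (+-identityʳ _) (δ-≡1 u≡x)
  ... | no ¬Ay | _    = ⊥-elim (¬Ay Ay)
  ... | yes _ | no ¬Bz = ⊥-elim (¬Bz Bz)

  pair-term≡0 : ∀ {y z x} → (A y → B z → y + z ≡ x [mod M ] → ⊥) → 𝟏A y * 𝟏B z * δ (y + z) x ≡ 0
  pair-term≡0 {y} {z} ¬tile with A? y | B? z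
  ... | yes Ay | yes Bz = trans (+-identityʳ _) (δ-≡0 (¬tile Ay Bz))
  ... | no _   | _      = refl
  ... | yes _  | no _   = refl

  𝟏A⋆𝟏B≈𝟙 : 𝟏A ⋆ 𝟏B ≈ 𝟙
  𝟏A⋆𝟏B≈𝟙 x x<M with α , β , Aα , Bβ , α+β≡x ← cover x x<M = begin
    (𝟏A ⋆ 𝟏B) x                   ≡⟨ ∑<-pick M α (A<M Aα) (λ y _ y≢α → ∑<-zero M λ z _ → pair-term≡0 {y} {z} (off-α y≢α)) ⟩
    ∑< M (λ z → term α z)         ≡⟨ ∑<-pick M β (B<M Bβ) (λ z _ z≢β → pair-term≡0 (off-β z≢β)) ⟩
    term α β                      ≡⟨ pair-term≡1 Aα Bβ α+β≡x ⟩
    1                             ∎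
    where
    open ≡-Reasoning
    term : ℕ → ℕ → ℕ
    term y z = 𝟏A y * 𝟏B z * δ (y + z) x
    off-α : ∀ {y z} → y ≢ α → A y → B z → y + z ≡ x [mod M ] → ⊥
    off-α y≢α Ay Bz y+z≡x = y≢α (proj₁ (unique Ay Bz Aα Bβ (≡mod-trans y+z≡x (≡mod-sym α+β≡x))))
    off-β : ∀ {z} → z ≢ β → A α → B z → α + z ≡ x [mod M ] → ⊥
    off-β z≢β Aα Bz α+z≡x = z≢β (proj₂ (unique Aα Bz Aα Bβ (≡mod-trans α+z≡x (≡mod-sym α+β≡x))))

  -- By Tijdeman exactly one pair (w, z) ∈ A × B has r w + z ≡ x, and both (a, b) and (a′, b′) do.
  dilation-unique : ∀ r .{{_ : NonZero r}} → NoCommonPrimeFactor r M →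
                    ∀ {a a′ b b′} → A a → A a′ → B b → B b′ → r * a + b ≡ r * a′ + b′ [mod M ] → a ≡ a′ × b ≡ b′
  dilation-unique r r⊥M {a} {a′} {b} {b′} Aa Aa′ Bb Bb′ ra+b≡ra′+b′ =
    ∑<²-≤1⇒unique M M term (≤-reflexive ∑term≡1) (A<M Aa) (B<M Bb) (A<M Aa′) (B<M Bb′)
      (≤-reflexive (sym (pair-term≡1 Aa Bb (≡mod-sym (%≡mod M (r * a + b))))))
      (≤-reflexive (sym (pair-term≡1 Aa′ Bb′ (≡mod-trans (≡mod-sym ra+b≡ra′+b′) (≡mod-sym (%≡mod M (r * a + b)))))))
    where
    x = (r * a + b) % M
    term : ℕ → ℕ → ℕ
    term w z = 𝟏A w * 𝟏B z * δ (r * w + z) x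
    ∑term≡1 : ∑< M (λ w → ∑< M (term w)) ≡ 1
    ∑term≡1 = trans (sym (dilate-⋆ r 𝟏A 𝟏B x)) (tijdeman r r⊥M 𝟏A 𝟏B 𝟏A⋆𝟏B≈𝟙 x (m%n<n (r * a + b) M))

  -- u and v stand for a − a′ and b′ − b.
  sands : ∀ {a a′ b b′} → A a → A a′ → B b → B b′ → ∀ u v → a′ + u ≡ a [mod M ] → b + v ≡ b′ [mod M ] →
          (∀ {e} → e ∣ M → e ∣ u → e ∣ v) → (∀ {e} → e ∣ M → e ∣ v → e ∣ u) → a ≡ a′ × b ≡ b′
  sands {a} {a′} {b} {b′} Aa Aa′ Bb Bb′ u v a′+u≡a b+v≡b′ u⇒v v⇒u =
    dilation-unique r {{r≢0}} r⊥M Aa Aa′ Bb Bb′ ra+b≡ra′+b′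
    where
    multiplier = unit-multiplier M u v u⇒v v⇒u
    r = proj₁ multiplier
    r≢0 = proj₁ (proj₂ multiplier)
    r⊥M = proj₁ (proj₂ (proj₂ multiplier))
    r*u≡v = proj₂ (proj₂ (proj₂ multiplier))
    ra+b≡ra′+b′ : r * a + b ≡ r * a′ + b′ [mod M ]
    ra+b≡ra′+b′ = begin
      r * a + b               ≈⟨ ≡mod-+ (≡mod-*ˡ r (≡mod-sym a′+u≡a)) ≡mod-refl ⟩
      r * (a′ + u) + b        ≡⟨ rearrange r a′ u b ⟩
      r * a′ + (r * u + b)    ≈⟨ ≡mod-+ (≡mod-refl {x = r * a′}) (≡mod-+ r*u≡v ≡mod-refl) ⟩
      r * a′ + (v + b)        ≡⟨ cong (r * a′ +_) (+-comm v b) ⟩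
      r * a′ + (b + v)        ≈⟨ ≡mod-+ (≡mod-refl {x = r * a′}) b+v≡b′ ⟩
      r * a′ + b′             ∎
      where
      open import Relation.Binary.Reasoning.Setoid (≡mod-setoid M)
      rearrange : ∀ r a′ u b → r * (a′ + u) + b ≡ r * a′ + (r * u + b)
      rearrange = solve-∀


-- Fibers

ConstantMod : ℕ → ℕ → (ℕ → ℕ) → Set
ConstantMod P n γ = ∀ {i j} → i < n → j < n → γ i ≡ γ j [mod P ]

module _ {P : ℕ} .{{_ : NonZero P}} {n : ℕ} (α β : ℕ → ℕ)
         (agree : ∀ {i j} → i < n → j < n → α i ≡ α j [mod P ] ⊎ β i ≡ β j [mod P ]) where

  β-agree : ∀ {i j} → i < n → j < n → ¬ α i ≡ α j [mod P ] → β i ≡ β j [mod P ]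
  β-agree i<n j<n αi≢αj with agree i<n j<n
  ... | inj₁ αi≡αj = ⊥-elim (αi≢αj αi≡αj)
  ... | inj₂ βi≡βj = βi≡βj

  β-agree-via : ∀ {i j c} → i < n → j < n → c < n → α i ≡ α j [mod P ] → ¬ α i ≡ α c [mod P ] → β i ≡ β j [mod P ]
  β-agree-via i<n j<n c<n αi≡αj αi≢αc = ≡mod-trans (β-agree i<n c<n αi≢αc)
    (≡mod-sym (β-agree j<n c<n (αi≢αc ∘ ≡mod-trans αi≡αj)))

  ¬constant⇒constant : ∀ {i₀ j₀} → i₀ < n → j₀ < n → ¬ α i₀ ≡ α j₀ [mod P ] → ConstantMod P n β
  ¬constant⇒constant {i₀} {j₀} i₀<n j₀<n αi₀≢αj₀ {i} {j} i<n j<n with agree i<n j<n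
  ... | inj₂ βi≡βj = βi≡βj
  ... | inj₁ αi≡αj with α i ≟ α i₀ [mod P ]
  ...   | yes αi≡αi₀ = β-agree-via i<n j<n j₀<n αi≡αj λ αi≡αj₀ → αi₀≢αj₀ (≡mod-trans (≡mod-sym αi≡αi₀) αi≡αj₀)
  ...   | no αi≢αi₀  = β-agree-via i<n j<n i₀<n αi≡αj αi≢αi₀

  constant⊎constant : 0 < n → ConstantMod P n α ⊎ ConstantMod P n β
  constant⊎constant 0<n with anyUpTo? (λ j → ¬? (α 0 ≟ α j [mod P ])) n
  ... | yes (j₀ , j₀<n , α0≢αj₀) = inj₂ (¬constant⇒constant 0<n j₀<n α0≢αj₀)
  ... | no ∄j = inj₁ λ i<n j<n → ≡mod-trans (≡mod-sym (α0≡ i<n)) (α0≡ j<n)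
    where
    α0≡ : ∀ {j} → j < n → α 0 ≡ α j [mod P ]
    α0≡ {j} j<n = decidable-stable (α 0 ≟ α j [mod P ]) λ α0≢αj → ∄j (j , j<n , α0≢αj)

-- The fiber through x in the p direction, where p^(1+j) ∥ M and s = M/p.
module Fiber (M : ℕ) .{{_ : NonZero M}} (A B : Subset) (tiling : Tiling M A B)
             {p j m s : ℕ} (pp : Prime p) (M≡ : M ≡ p ^ suc j * m) (p∤m : ¬ p ∣ m) (s*p≡M : s * p ≡ M) (x : ℕ) where
  open TilingProperties M A B tiling

  instance
    _ = prime⇒nonZero pp
    _ = m^n≢0 p (suc j)

  s≡p^j*m : s ≡ p ^ j * m
  s≡p^j*m = *-cancelʳ-≡ s (p ^ j * m) p (trans s*p≡M (trans M≡ (trans (*-assoc p (p ^ j) m) (*-comm p (p ^ j * m)))))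

  p^[1+j]∣M : p ^ suc j ∣ M
  p^[1+j]∣M = divides m (trans M≡ (*-comm (p ^ suc j) m))

  p^j∣p^[1+j] : p ^ j ∣ p ^ suc j
  p^j∣p^[1+j] = divides p refl

  p^j∣s : p ^ j ∣ s
  p^j∣s = divides m (trans s≡p^j*m (*-comm (p ^ j) m))

  ∤s⇒p^[1+j]∣ : ∀ {d} → d ∣ M → ¬ d ∣ s → p ^ suc j ∣ d
  ∤s⇒p^[1+j]∣ {d} d∣M d∤s = decidable-stable (p ^ suc j ∣? d) λ p^[1+j]∤d →
    d∤s (subst (d ∣_) (sym s≡p^j*m) (∣p^[1+j]*m⇒∣p^j*m pp m j (subst (d ∣_) M≡ d∣M) p^[1+j]∤d))

  record OnFiber (a b k : ℕ) : Set where
    constructor on-fiber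
    field
      A∋a : A a
      B∋b : B b
      k<p : k < p
      a+b≡ : a + b ≡ x + k * s [mod M ]

  Z : Subset
  Z = InFiber M s p x

  ΣA⇒OnFiber : ∀ {a} → ΣA A B Z a → ∃₂ λ b k → OnFiber a b k
  ΣA⇒OnFiber (Aa , b , Bb , k , k<p , M∣) = b , k , on-fiber Aa Bb k<p (∣-∣⇒≡mod M∣)

  ΣB⇒OnFiber : ∀ {b} → ΣB A B Z b → ∃₂ λ a k → OnFiber a b k
  ΣB⇒OnFiber (Bb , a , Aa , k , k<p , M∣) = a , k , on-fiber Aa Bb k<p (∣-∣⇒≡mod M∣)

  OnFiber⇒≡x : ∀ {a b k d} → OnFiber a b k → d ∣ M → d ∣ s → a + b ≡ x [mod d ]
  OnFiber⇒≡x {k = k} (on-fiber _ _ _ a+b≡) d∣M d∣s = ≡mod-trans (≡mod-∣ d∣M a+b≡) (≡mod-+-∣ (∣n⇒∣m*n k d∣s))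

  module _ {a b k a′ b′ k′} (on : OnFiber a b k) (on′ : OnFiber a′ b′ k′) where

    A-close⇒B-close : a ≡ a′ [mod p ^ suc j ] → b ≡ b′ [mod p ^ j ]
    A-close⇒B-close a≡a′ = ≡mod-+-cancelˡ a (≡mod-trans (≡mod-trans (OnFiber⇒≡x on p^j∣M p^j∣s)
      (≡mod-sym (OnFiber⇒≡x on′ p^j∣M p^j∣s))) (≡mod-+ (≡mod-sym (≡mod-∣ p^j∣p^[1+j] a≡a′)) ≡mod-refl))
      where p^j∣M = ∣-trans p^j∣p^[1+j] p^[1+j]∣M

    B-close⇒A-close : b ≡ b′ [mod p ^ suc j ] → a ≡ a′ [mod p ^ j ]
    B-close⇒A-close b≡b′ = ≡mod-+-cancelʳ b (≡mod-trans (≡mod-trans (OnFiber⇒≡x on p^j∣M p^j∣s)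
      (≡mod-sym (OnFiber⇒≡x on′ p^j∣M p^j∣s))) (≡mod-+ ≡mod-refl (≡mod-sym (≡mod-∣ p^j∣p^[1+j] b≡b′))))
      where p^j∣M = ∣-trans p^j∣p^[1+j] p^[1+j]∣M

    private
      module O = OnFiber on
      module O′ = OnFiber on′

    close⇒same-step : a ≡ a′ [mod p ^ suc j ] → b ≡ b′ [mod p ^ suc j ] → k ≡ k′
    close⇒same-step a≡a′ b≡b′ = *-cancelʳ-≡mod-p^[1+j] pp j p∤m O.k<p O′.k<p
      (subst₂ (λ t t′ → k * t ≡ k′ * t′ [mod p ^ suc j ]) s≡p^j*m s≡p^j*m (≡mod-+-cancelˡ x
        (≡mod-trans (≡mod-sym (≡mod-∣ p^[1+j]∣M O.a+b≡)) (≡mod-trans (≡mod-+ a≡a′ b≡b′) (≡mod-∣ p^[1+j]∣M O′.a+b≡)))))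

    close⇒equal : a ≡ a′ [mod p ^ suc j ] → b ≡ b′ [mod p ^ suc j ] → a ≡ a′ × b ≡ b′
    close⇒equal a≡a′ b≡b′ = unique O.A∋a O.B∋b O′.A∋a O′.B∋b (≡mod-trans O.a+b≡
      (≡mod-trans (≡mod-reflexive (cong (λ t → x + t * s) (close⇒same-step a≡a′ b≡b′))) (≡mod-sym O′.a+b≡)))

    -- Otherwise a − a′ and b′ − b have the same divisors in M: they agree modulo every divisor
    -- of s, and p^(1+j) divides neither.
    close⊎close : a ≡ a′ [mod p ^ suc j ] ⊎ b ≡ b′ [mod p ^ suc j ]
    close⊎close with a ≟ a′ [mod p ^ suc j ] | b ≟ b′ [mod p ^ suc j ]
    ... | yes a≡a′ | _        = inj₁ a≡a′
    ... | no _     | yes b≡b′ = inj₂ b≡b′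
    ... | no a≢a′  | no b≢b′
      with u , a′+u≡a ← ≡mod-difference M a a′ | v , b+v≡b′ ← ≡mod-difference M b′ b
      = ⊥-elim (a≢a′ (≡mod-reflexive (proj₁ (sands O.A∋a O′.A∋a O.B∋b O′.B∋b u v a′+u≡a b+v≡b′ u⇒v v⇒u))))
      where
      u≡v : ∀ {e} → e ∣ M → e ∣ s → u ≡ v [mod e ]
      u≡v {e} e∣M e∣s = ≡mod-+-cancelʳ x (begin
        u + x          ≈⟨ ≡mod-+ (≡mod-refl {x = u}) (≡mod-sym (OnFiber⇒≡x on′ e∣M e∣s)) ⟩
        u + (a′ + b′)  ≡⟨ trans (sym (+-assoc u a′ b′)) (cong (_+ b′) (+-comm u a′)) ⟩
        a′ + u + b′    ≈⟨ ≡mod-∣ e∣M (≡mod-+ a′+u≡a ≡mod-refl) ⟩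
        a + b′         ≈⟨ ≡mod-∣ e∣M (≡mod-+ (≡mod-refl {x = a}) (≡mod-sym b+v≡b′)) ⟩
        a + (b + v)    ≡⟨ trans (sym (+-assoc a b v)) (+-comm (a + b) v) ⟩
        v + (a + b)    ≈⟨ ≡mod-+ (≡mod-refl {x = v}) (OnFiber⇒≡x on e∣M e∣s) ⟩
        v + x          ∎)
        where open import Relation.Binary.Reasoning.Setoid (≡mod-setoid e)
      u⇒v : ∀ {e} → e ∣ M → e ∣ u → e ∣ v
      u⇒v {e} e∣M e∣u with e ∣? s
      ... | yes e∣s = ≡0⇒∣ (≡mod-trans (≡mod-sym (u≡v e∣M e∣s)) (∣⇒≡0 e∣u))
      ... | no e∤s  = ⊥-elim (a≢a′ (≡mod-trans (≡mod-sym (≡mod-∣ p^[1+j]∣M a′+u≡a))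
                        (≡mod-+-∣ (∣-trans (∤s⇒p^[1+j]∣ e∣M e∤s) e∣u))))
      v⇒u : ∀ {e} → e ∣ M → e ∣ v → e ∣ u
      v⇒u {e} e∣M e∣v with e ∣? s
      ... | yes e∣s = ≡0⇒∣ (≡mod-trans (u≡v e∣M e∣s) (∣⇒≡0 e∣v))
      ... | no e∤s  = ⊥-elim (b≢b′ (≡mod-trans (≡mod-sym (≡mod-+-∣ (∣-trans (∤s⇒p^[1+j]∣ e∣M e∤s) e∣v)))
                        (≡mod-∣ p^[1+j]∣M b+v≡b′)))

  SA SB : Subset
  SA = ΣA A B Z
  SB = ΣB A B Z

  decomposition : ∀ k → ∃[ a ] ∃[ b ] (A a × B b × a + b ≡ (x + k * s) % M [mod M ])
  decomposition k = cover ((x + k * s) % M) (m%n<n (x + k * s) M)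

  α β : ℕ → ℕ
  α k = proj₁ (decomposition k)
  β k = proj₁ (proj₂ (decomposition k))

  canonical : ∀ {k} → k < p → OnFiber (α k) (β k) k
  canonical {k} k<p = on-fiber A∋α B∋β k<p (≡mod-trans α+β≡ (%≡mod M (x + k * s)))
    where
    A∋α = proj₁ (proj₂ (proj₂ (decomposition k)))
    B∋β = proj₁ (proj₂ (proj₂ (proj₂ (decomposition k))))
    α+β≡ = proj₂ (proj₂ (proj₂ (proj₂ (decomposition k))))

  OnFiber⇒canonical : ∀ {a b k} → OnFiber a b k → a ≡ α k × b ≡ β k
  OnFiber⇒canonical (on-fiber Aa Bb k<p a+b≡) with on-fiber Aα Bβ _ α+β≡ ← canonical k<p =
    unique Aa Bb Aα Bβ (≡mod-trans a+b≡ (≡mod-sym α+β≡))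

  α-close : ∀ {a b k a′ b′ k′} → ConstantMod (p ^ suc j) p α → OnFiber a b k → OnFiber a′ b′ k′ → a ≡ a′ [mod p ^ suc j ]
  α-close const on on′ with refl , _ ← OnFiber⇒canonical on | refl , _ ← OnFiber⇒canonical on′ =
    const (OnFiber.k<p on) (OnFiber.k<p on′)

  β-close : ∀ {a b k a′ b′ k′} → ConstantMod (p ^ suc j) p β → OnFiber a b k → OnFiber a′ b′ k′ → b ≡ b′ [mod p ^ suc j ]
  β-close const on on′ with _ , refl ← OnFiber⇒canonical on | _ , refl ← OnFiber⇒canonical on′ =
    const (OnFiber.k<p on) (OnFiber.k<p on′)

  splits-A : ConstantMod (p ^ suc j) p α → SplitsWithParity p (suc j) SA SB
  splits-A const = A-parts-agree , B-parts-differ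
    where
    A-parts-agree : ∀ a a′ → SA a → SA a′ → (p ^ suc j ∣- a) a′
    A-parts-agree _ _ sa sa′ with _ , _ , on ← ΣA⇒OnFiber sa | _ , _ , on′ ← ΣA⇒OnFiber sa′ =
      ≡mod⇒∣-∣ (α-close const on on′)
    B-parts-differ : ∀ b b′ → SB b → SB b′ → b ≢ b′ → (p ^ j ∣- b) b′ × ¬ (p ^ suc j ∣- b) b′
    B-parts-differ _ _ sb sb′ b≢b′ with _ , _ , on ← ΣB⇒OnFiber sb | _ , _ , on′ ← ΣB⇒OnFiber sb′ =
      ≡mod⇒∣-∣ (A-close⇒B-close on on′ (α-close const on on′)) ,
      λ P∣ → b≢b′ (proj₂ (close⇒equal on on′ (α-close const on on′) (∣-∣⇒≡mod P∣)))

  splits-B : ConstantMod (p ^ suc j) p β → SplitsWithParity p (suc j) SB SA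
  splits-B const = B-parts-agree , A-parts-differ
    where
    B-parts-agree : ∀ b b′ → SB b → SB b′ → (p ^ suc j ∣- b) b′
    B-parts-agree _ _ sb sb′ with _ , _ , on ← ΣB⇒OnFiber sb | _ , _ , on′ ← ΣB⇒OnFiber sb′ =
      ≡mod⇒∣-∣ (β-close const on on′)
    A-parts-differ : ∀ a a′ → SA a → SA a′ → a ≢ a′ → (p ^ j ∣- a) a′ × ¬ (p ^ suc j ∣- a) a′
    A-parts-differ _ _ sa sa′ a≢a′ with _ , _ , on ← ΣA⇒OnFiber sa | _ , _ , on′ ← ΣA⇒OnFiber sa′ =
      ≡mod⇒∣-∣ (B-close⇒A-close on on′ (β-close const on on′)) ,
      λ P∣ → a≢a′ (proj₁ (close⇒equal on on′ (∣-∣⇒≡mod P∣) (β-close const on on′)))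

  fiber-splits : SplitsWithParity p (suc j) SA SB ⊎ SplitsWithParity p (suc j) SB SA
  fiber-splits with constant⊎constant α β (λ k<p k′<p → close⊎close (canonical k<p) (canonical k′<p)) (>-nonZero⁻¹ p)
  ... | inj₁ α-const = inj₁ (splits-A α-const)
  ... | inj₂ β-const = inj₂ (splits-B β-const)

  SA-≡[mod-p^j] : ∀ a a′ → SA a → SA a′ → (p ^ j ∣- a) a′
  SA-≡[mod-p^j] _ _ sa sa′ with _ , _ , on ← ΣA⇒OnFiber sa | _ , _ , on′ ← ΣA⇒OnFiber sa′ with close⊎close on on′
  ... | inj₁ a≡a′ = ≡mod⇒∣-∣ (≡mod-∣ p^j∣p^[1+j] a≡a′)
  ... | inj₂ b≡b′ = ≡mod⇒∣-∣ (B-close⇒A-close on on′ b≡b′)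

  SB-≡[mod-p^j] : ∀ b b′ → SB b → SB b′ → (p ^ j ∣- b) b′
  SB-≡[mod-p^j] _ _ sb sb′ with _ , _ , on ← ΣB⇒OnFiber sb | _ , _ , on′ ← ΣB⇒OnFiber sb′ with close⊎close on on′
  ... | inj₁ a≡a′ = ≡mod⇒∣-∣ (A-close⇒B-close on on′ a≡a′)
  ... | inj₂ b≡b′ = ≡mod⇒∣-∣ (≡mod-∣ p^j∣p^[1+j] b≡b′)


prime∤prodFin : ∀ K (p n : Fin K → ℕ) → (∀ ν → Prime (p ν)) → ∀ {q} → Prime q → (∀ ν → ¬ q ≡ p ν) →
                ¬ q ∣ prodFin K (λ ν → p ν ^ n ν)
prime∤prodFin zero    p n pr pq q≢p q∣1 = prime⇒∤1 pq q∣1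
prime∤prodFin (suc K) p n pr pq q≢p q∣ with euclidsLemma (p zero ^ n zero) _ pq q∣
... | inj₁ q∣p₀^n₀ = q≢p zero (prime∣prime⇒≡ pq (pr zero) (prime∣^⇒∣ pq (p zero) (n zero) q∣p₀^n₀))
... | inj₂ q∣rest  = prime∤prodFin K (p ∘ suc) (n ∘ suc) (pr ∘ suc) pq (λ ν → q≢p (suc ν)) q∣rest

prodFin-split : ∀ K (p n : Fin K → ℕ) → (∀ ν → Prime (p ν)) → Injective _≡_ _≡_ p → ∀ i →
                ∃ λ m → prodFin K (λ ν → p ν ^ n ν) ≡ p i ^ n i * m × ¬ p i ∣ m
prodFin-split (suc K) p n pr inj zero = _ , refl ,
  prime∤prodFin K (p ∘ suc) (n ∘ suc) (pr ∘ suc) (pr zero) (λ ν → Finₚ.0≢1+n ∘ inj)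
prodFin-split (suc K) p n pr inj (suc i)
  with m , M′≡ , p∤m ← prodFin-split K (p ∘ suc) (n ∘ suc) (pr ∘ suc) (Finₚ.suc-injective ∘ inj) i
  = p zero ^ n zero * m
  , trans (cong (p zero ^ n zero *_) M′≡) (x∙yz≈y∙xz (p zero ^ n zero) (p (suc i) ^ n (suc i)) m)
  , p∤
  where
  p∤ : ¬ p (suc i) ∣ p zero ^ n zero * m
  p∤ q∣ with euclidsLemma (p zero ^ n zero) m (pr (suc i)) q∣
  ... | inj₁ q∣p₀^n₀
    with () ← inj (prime∣prime⇒≡ (pr (suc i)) (pr zero) (prime∣^⇒∣ (pr (suc i)) (p zero) (n zero) q∣p₀^n₀))
  ... | inj₂ q∣m = p∤m q∣m

lemma4p3 : (K : ℕ) (p : Fin K → ℕ) (n : Fin K → ℕ)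
    → (∀ ν → Prime (p ν)) → Injective _≡_ _≡_ p → (∀ ν → 1 ≤ n ν)
    → (A B : Subset) → Tiling (prodFin K (λ ν → p ν ^ n ν)) A B
    → (i : Fin K) (s x : ℕ) → s * p i ≡ prodFin K (λ ν → p ν ^ n ν)
    → x < prodFin K (λ ν → p ν ^ n ν)
    → (SplitsWithParity (p i) (n i)
          (ΣA A B (InFiber (prodFin K (λ ν → p ν ^ n ν)) s (p i) x))
          (ΣB A B (InFiber (prodFin K (λ ν → p ν ^ n ν)) s (p i) x))
       ⊎ SplitsWithParity (p i) (n i)
          (ΣB A B (InFiber (prodFin K (λ ν → p ν ^ n ν)) s (p i) x))
          (ΣA A B (InFiber (prodFin K (λ ν → p ν ^ n ν)) s (p i) x)))
      × (∀ a a' → ΣA A B (InFiber (prodFin K (λ ν → p ν ^ n ν)) s (p i) x) a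
                → ΣA A B (InFiber (prodFin K (λ ν → p ν ^ n ν)) s (p i) x) a'
                → (p i ^ (n i ∸ 1) ∣- a) a')
      × (∀ b b' → ΣB A B (InFiber (prodFin K (λ ν → p ν ^ n ν)) s (p i) x) b
                → ΣB A B (InFiber (prodFin K (λ ν → p ν ^ n ν)) s (p i) x) b'
                → (p i ^ (n i ∸ 1) ∣- b) b')
lemma4p3 K p n pr inj n≥1 A B tiling i s x s*p≡M _
  with m , M≡ , p∤m ← prodFin-split K p n pr inj i
  with n i | n≥1 i | M≡
... | suc j | _ | M≡p^[1+j]*m = fiber-splits , SA-≡[mod-p^j] , SB-≡[mod-p^j]
  where
  instance
    _ = prime⇒nonZero (pr i)
    _ = m^n≢0 (p i) (suc j)
    _ = ≢-nonZero λ { refl → p∤m (p i ∣0) }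
    _ = subst NonZero (sym M≡p^[1+j]*m) (m*n≢0 (p i ^ suc j) m)
  open Fiber (prodFin K (λ ν → p ν ^ n ν)) A B tiling {p i} {j} {m} {s} (pr i) M≡p^[1+j]*m p∤m s*p≡M x
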